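{- For any prime $g \geq 3$, any $\varepsilon>0$, and real $X\ge 2$, $Z$ with $X^{\frac{1}{2g}} \le Z \le X$, \[ \sum_{X \leq d < 2X}S_g(d;Z) \ll X^\varepsilon \{ Z^2X^{1/2} +Z^{g+2}X^{ -1/2}\},\] where the sum runs over square-free integers $d\in[X,2X)$ and the implied constant depends only on $\varepsilon$ and $g$.
   Context: $S_g(d;Z)$ denotes the number of pairs of primes $p,p'$ with $Z \leq p \neq p' < 2Z$ for which there exist $u,v \in \mathbb{Z} \setminus \{0\}$ with $\gcd(v,pp')=1$ and $4(pp')^g = u^2+dv^2$.
   Formalization: The parameters X, Z and ε range over the rationals rather than the reals. -}

module Defs where

open import Data.Nat as ℕ using (ℕ; zero; suc)
open import Data.Nat.Divisibility using (_∣_)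
open import Data.Nat.Primality using (Prime)
open import Data.Nat.GCD using (gcd)
open import Data.Integer as ℤ using (ℤ; +_)
open import Data.Rational as ℚ using (ℚ)
open import Data.Product using (_×_; ∃₂; _,_)
open import Relation.Binary.PropositionalEquality using (_≡_; _≢_)

infixr 8 _^ℚ_
_^ℚ_ : ℚ → ℕ → ℚ
q ^ℚ zero  = ℚ.1ℚ
q ^ℚ suc n = q ℚ.* (q ^ℚ n)

ι : ℕ → ℚ
ι n = (+ n) ℚ./ 1

SquareFree : ℕ → Set
SquareFree d = (0 ℕ.< d) × (∀ n → n ℕ.* n ∣ d → n ≡ 1)

SCond : ℕ → ℚ → ℕ → ℕ → ℕ → Set
SCond g Z d p p' =
  Prime p × Prime p' × p ≢ p' ×
  (Z ℚ.≤ ι p) × (ι p ℚ.< 2ℚ ℚ.* Z) ×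
  (Z ℚ.≤ ι p') × (ι p' ℚ.< 2ℚ ℚ.* Z) ×
  ∃₂ λ (u v : ℤ) → u ≢ + 0 × v ≢ + 0 × gcd ℤ.∣ v ∣ (p ℕ.* p') ≡ 1 ×
    (+ 4 ℤ.* ((+ (p ℕ.* p')) ℤ.^ g) ≡ u ℤ.* u ℤ.+ ((+ d) ℤ.* (v ℤ.* v)))
  where 2ℚ = ι 2

-- membership of a triple (d, p, p') in the set counted by Σ_{X ≤ d < 2X, d squarefree} S_g(d;Z)
Counted : ℕ → ℚ → ℚ → ℕ × ℕ × ℕ → Set
Counted g X Z (d , p , p') =
  SquareFree d × (X ℚ.≤ ι d) × (ι d ℚ.< ι 2 ℚ.* X) × SCond g Z d p p'

module Submission where

-- Each counted triple (d, p, p′) comes with a solution w² + d v² = 4 N^g, N = p p′, where w = ∣u∣ and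
-- v = ∣v∣ ≥ 1; we count solutions fibrewise over (p, p′, v).  Within a fibre w² ≡ 4 N^g (mod v²) and
-- the quotient d lies in a window of length about X, so two roots agree up to sign modulo every prime
-- power dividing v² (dividing (v/2)² when v is even), and two roots in the same residue class are at
-- most about v √X apart.  The fibre therefore has at most 2^ω(v) (1 + 2 √(32 X) / v) elements, and
-- 2^ω(v) ≤ (K_B v²)^(1/B) for every B.  Summing over v ≤ S ≈ Z^g / √X produces a harmonic sum, and over
-- p, p′ < 2 Z a factor Z², so the count is ≪ X^ε Z² (S + √X log S) ≪ X^ε (Z² √X + Z^(g+2) / √X).
-- The rational inequality of the statement is this bound raised to the power 2b, where ε = a / b.

module Arithmetic where

  open import Data.Nat
  open import Data.Nat.DivMod
  open import Data.Nat.Properties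
  open import Data.Nat.Tactic.RingSolver using (solve-∀)
  open import Data.Product using (∃; _×_; _,_)
  open import Data.Sum using (inj₁; inj₂; [_,_]′)
  open import Data.Empty using (⊥-elim)
  open import Relation.Nullary using (¬_; Dec; yes; no)
  open import Relation.Binary.PropositionalEquality

  crossing : {P : ℕ → Set} → (∀ n → Dec (P n)) → P 0 → ∀ n → ¬ P n → ∃ λ r → P r × ¬ P (suc r)
  crossing P? p0 zero ¬p = ⊥-elim (¬p p0)
  crossing P? p0 (suc n) ¬p with P? n
  ... | yes p = n , p , ¬p
  ... | no ¬p′ = crossing P? p0 n ¬p′

  ^-distrib-* : ∀ m n o → (m * n) ^ o ≡ m ^ o * n ^ o
  ^-distrib-* m n zero = refl
  ^-distrib-* m n (suc o) = begin
    m * n * (m * n) ^ o     ≡⟨ cong (m * n *_) (^-distrib-* m n o) ⟩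
    m * n * (m ^ o * n ^ o) ≡⟨ interchange m n (m ^ o) (n ^ o) ⟩
    m * m ^ o * (n * n ^ o) ∎
    where
    open ≡-Reasoning
    interchange : ∀ a b c d → a * b * (c * d) ≡ a * c * (b * d)
    interchange = solve-∀

  [m*m]^k≡m^[2k] : ∀ m k → (m * m) ^ k ≡ m ^ (2 * k)
  [m*m]^k≡m^[2k] m k = trans (^-distrib-* m m k) (trans (sym (^-distribˡ-+-* m k k)) (cong (λ e → m ^ (k + e)) (sym (+-identityʳ k))))

  m≤m^n : ∀ m n .{{_ : NonZero n}} → m ≤ m ^ n
  m≤m^n zero    (suc n) = z≤n
  m≤m^n (suc m) (suc n) = m≤m*n (suc m) (suc m ^ n) {{m^n≢0 (suc m) n}}

  0^n≡0 : ∀ n .{{_ : NonZero n}} → 0 ^ n ≡ 0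
  0^n≡0 (suc n) = refl

  ^-cancelʳ-≤ : ∀ n .{{_ : NonZero n}} {a b} → a ^ n ≤ b ^ n → a ≤ b
  ^-cancelʳ-≤ n aⁿ≤bⁿ = ≮⇒≥ λ b<a → <⇒≱ (^-monoˡ-< n b<a) aⁿ≤bⁿ

  n<2^n : ∀ n → n < 2 ^ n
  n<2^n zero    = s≤s z≤n
  n<2^n (suc n) = +-mono-≤ (m^n>0 2 n) (≤-trans (n<2^n n) (m≤m+n (2 ^ n) 0))

  [1+n]^m≤m^m*2^n : ∀ m .{{_ : NonZero m}} n → suc n ^ m ≤ m ^ m * 2 ^ n
  [1+n]^m≤m^m*2^n m n = begin
    suc n ^ m             ≤⟨ ^-monoˡ-≤ m 1+n≤m*[1+q] ⟩
    (m * suc q) ^ m       ≡⟨ ^-distrib-* m (suc q) m ⟩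
    m ^ m * suc q ^ m     ≤⟨ *-monoʳ-≤ (m ^ m) (^-monoˡ-≤ m (n<2^n q)) ⟩
    m ^ m * (2 ^ q) ^ m   ≡⟨ cong (m ^ m *_) (^-*-assoc 2 q m) ⟩
    m ^ m * 2 ^ (q * m)   ≤⟨ *-monoʳ-≤ (m ^ m) (^-monoʳ-≤ 2 (m/n*n≤m n m)) ⟩
    m ^ m * 2 ^ n         ∎
    where
    open ≤-Reasoning
    q : ℕ
    q = n / m
    1+n≤m*[1+q] : suc n ≤ m * suc q
    1+n≤m*[1+q] = begin
      suc n             ≡⟨ cong suc (m≡m%n+[m/n]*n n m) ⟩
      suc (n % m + q * m) ≤⟨ +-monoˡ-≤ (q * m) (m%n<n n m) ⟩
      m + q * m         ≡⟨ cong (m +_) (*-comm q m) ⟩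
      m + m * q         ≡⟨ sym (*-suc m q) ⟩
      m * suc q         ∎

  approximate-root : ∀ m .{{_ : NonZero m}} n .{{_ : NonZero n}} → ∃ λ r → n ≤ r ^ m × r ^ m ≤ 2 ^ m * n
  approximate-root m n with crossing (λ r → r ^ m ≤? n) 0ᵐ≤n (suc n) (λ [1+n]ᵐ≤n → <⇒≱ ≤-refl (≤-trans (m≤m^n (suc n) m) [1+n]ᵐ≤n))
    where
    0ᵐ≤n : 0 ^ m ≤ n
    0ᵐ≤n = ≤-trans (≤-reflexive (0^n≡0 m)) z≤n
  ... | r , rᵐ≤n , [1+r]ᵐ≰n = suc r , ≰⇒≥ [1+r]ᵐ≰n , (begin
    suc r ^ m       ≤⟨ ^-monoˡ-≤ m 1+r≤2r ⟩
    (2 * r) ^ m     ≡⟨ ^-distrib-* 2 r m ⟩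
    2 ^ m * r ^ m   ≤⟨ *-monoʳ-≤ (2 ^ m) rᵐ≤n ⟩
    2 ^ m * n       ∎)
    where
    open ≤-Reasoning
    r≢0 : r ≢ 0
    r≢0 refl = [1+r]ᵐ≰n (≤-trans (≤-reflexive (^-zeroˡ m)) (>-nonZero⁻¹ n))
    1+r≤2r : suc r ≤ 2 * r
    1+r≤2r = ≤-trans (+-monoˡ-≤ r (n≢0⇒n>0 r≢0)) (≤-reflexive (cong (r +_) (sym (+-identityʳ r))))

  dyadic-interval : ∀ n .{{_ : NonZero n}} → ∃ λ j → 2 ^ j ≤ n × n < 2 ^ suc j
  dyadic-interval n with crossing (λ j → 2 ^ j ≤? n) (>-nonZero⁻¹ n) n (<⇒≱ (n<2^n n))
  ... | j , 2ʲ≤n , 2ʲ⁺¹≰n = j , 2ʲ≤n , ≰⇒> 2ʲ⁺¹≰n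

  greatest-square-multiple : ∀ c .{{_ : NonZero c}} Q → ∃ λ r → r * r * c ≤ Q × (∀ t → t * t * c ≤ Q → t ≤ r)
  greatest-square-multiple c Q with crossing (λ t → t * t * c ≤? Q) z≤n (suc Q) too-big
    where
    too-big : ¬ (suc Q * suc Q * c ≤ Q)
    too-big h = <⇒≱ ≤-refl (≤-trans (≤-trans (m≤m*n (suc Q) (suc Q)) (m≤m*n (suc Q * suc Q) c)) h)
  ... | r , r²c≤Q , [1+r]²c≰Q = r , r²c≤Q , λ t t²c≤Q → ≮⇒≥ λ r<t → [1+r]²c≰Q (≤-trans (*-monoˡ-≤ c (*-mono-≤ r<t r<t)) t²c≤Q)

  harmonic : ℕ → ℕ → ℕ
  harmonic y zero    = 0
  harmonic y (suc n) = y / suc n + harmonic y n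

  harmonic-+ : ∀ y h k → harmonic y (k + h) ≤ k * (y / suc h) + harmonic y h
  harmonic-+ y h zero    = ≤-refl
  harmonic-+ y h (suc k) = begin
    y / suc (k + h) + harmonic y (k + h)           ≤⟨ +-mono-≤ (/-monoʳ-≤ y (s≤s (m≤n+m h k))) (harmonic-+ y h k) ⟩
    y / suc h + (k * (y / suc h) + harmonic y h)   ≡⟨ sym (+-assoc (y / suc h) _ _) ⟩
    suc k * (y / suc h) + harmonic y h             ∎
    where open ≤-Reasoning

  harmonic-≤ : ∀ y j {n} → n < 2 ^ j → harmonic y n ≤ j * y
  harmonic-≤ y zero    {zero}  _ = z≤n
  harmonic-≤ y zero    {suc n} (s≤s ())
  harmonic-≤ y (suc j) {n} n<2ʲ⁺¹ = begin
    harmonic y n                           ≡⟨ cong (harmonic y) (sym (m∸n+n≡m h≤n)) ⟩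
    harmonic y (n ∸ h + h)                 ≤⟨ harmonic-+ y h (n ∸ h) ⟩
    (n ∸ h) * (y / suc h) + harmonic y h   ≤⟨ +-mono-≤ upper-half (harmonic-≤ y j h<2ʲ) ⟩
    y + j * y                              ∎
    where
    open ≤-Reasoning
    h : ℕ
    h = n / 2
    h≤n : h ≤ n
    h≤n = m/n≤m n 2
    h<2ʲ : h < 2 ^ j
    h<2ʲ = m<n*o⇒m/o<n (subst (n <_) (*-comm 2 (2 ^ j)) n<2ʲ⁺¹)
    n∸h≤1+h : n ∸ h ≤ suc h
    n∸h≤1+h = m≤n+o⇒m∸n≤o n h (begin
      n                  ≡⟨ m≡m%n+[m/n]*n n 2 ⟩
      n % 2 + h * 2      ≤⟨ +-monoˡ-≤ (h * 2) (≤-pred (m%n<n n 2)) ⟩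
      suc (h * 2)        ≡⟨ cong suc (trans (*-comm h 2) (cong (h +_) (+-identityʳ h))) ⟩
      suc (h + h)        ≡⟨ sym (+-suc h h) ⟩
      h + suc h          ∎)
    upper-half : (n ∸ h) * (y / suc h) ≤ y
    upper-half = ≤-trans (*-monoˡ-≤ (y / suc h) n∸h≤1+h) (≤-trans (≤-reflexive (*-comm (suc h) _)) (m/n*n≤m y (suc h)))

  [m+n]^k≤2^k*o : ∀ k {m n o} → m ^ k ≤ o → n ^ k ≤ o → (m + n) ^ k ≤ 2 ^ k * o
  [m+n]^k≤2^k*o k {m} {n} {o} mᵏ≤o nᵏ≤o =
    [ (λ m≤n → twice-larger (+-monoˡ-≤ n m≤n) nᵏ≤o) , (λ n≤m → twice-larger (+-monoʳ-≤ m n≤m) mᵏ≤o) ]′ (≤-total m n)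
    where
    twice-larger : ∀ {l} → m + n ≤ l + l → l ^ k ≤ o → (m + n) ^ k ≤ 2 ^ k * o
    twice-larger {l} m+n≤2l lᵏ≤o = begin
      (m + n) ^ k       ≤⟨ ^-monoˡ-≤ k (≤-trans m+n≤2l (≤-reflexive (cong (l +_) (sym (+-identityʳ l))))) ⟩
      (2 * l) ^ k       ≡⟨ ^-distrib-* 2 l k ⟩
      2 ^ k * l ^ k     ≤⟨ *-monoʳ-≤ (2 ^ k) lᵏ≤o ⟩
      2 ^ k * o         ∎
      where open ≤-Reasoning

  n^[2b]*[2x]^b≤ : ∀ {n x b D u v} → n ^ (2 * b) * x ^ b ≤ D ^ (2 * b) * u * v →
                   n ^ (2 * b) * (2 * x) ^ b ≤ (2 * D) ^ (2 * b) * u * v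
  n^[2b]*[2x]^b≤ {n} {x} {b} {D} {u} {v} bound = begin
    n ^ (2 * b) * (2 * x) ^ b              ≡⟨ cong (n ^ (2 * b) *_) (^-distrib-* 2 x b) ⟩
    n ^ (2 * b) * (2 ^ b * x ^ b)          ≡⟨ x*[y*z]≡y*[x*z] (n ^ (2 * b)) (2 ^ b) (x ^ b) ⟩
    2 ^ b * (n ^ (2 * b) * x ^ b)          ≤⟨ *-mono-≤ (^-monoʳ-≤ 2 (m≤n*m b 2)) bound ⟩
    2 ^ (2 * b) * (D ^ (2 * b) * u * v)    ≡⟨ regroup (2 ^ (2 * b)) (D ^ (2 * b)) u v ⟩
    2 ^ (2 * b) * D ^ (2 * b) * u * v      ≡⟨ cong (λ c → c * u * v) (sym (^-distrib-* 2 D (2 * b))) ⟩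
    (2 * D) ^ (2 * b) * u * v              ∎
    where
    open ≤-Reasoning
    x*[y*z]≡y*[x*z] : ∀ a b c → a * (b * c) ≡ b * (a * c)
    x*[y*z]≡y*[x*z] = solve-∀
    regroup : ∀ a b c d → a * (b * c * d) ≡ a * b * c * d
    regroup = solve-∀

  a*b≤a*a+b*b : ∀ a b → a * b ≤ a * a + b * b
  a*b≤a*a+b*b a b with ≤-total a b
  ... | inj₁ a≤b = ≤-trans (*-monoˡ-≤ b a≤b) (m≤n+m (b * b) (a * a))
  ... | inj₂ b≤a = ≤-trans (*-monoʳ-≤ a b≤a) (m≤m+n (a * a) (b * b))

  [a+b]²≤4[a²+b²] : ∀ a b → (a + b) * (a + b) ≤ 4 * (a * a + b * b)
  [a+b]²≤4[a²+b²] a b = begin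
    (a + b) * (a + b)             ≡⟨ expand a b ⟩
    a * a + b * b + 2 * (a * b)   ≤⟨ +-monoʳ-≤ (a * a + b * b) (*-monoʳ-≤ 2 (a*b≤a*a+b*b a b)) ⟩
    c + 2 * c                     ≤⟨ m≤m+n (c + 2 * c) c ⟩
    c + 2 * c + c                 ≡⟨ collect c ⟩
    4 * c                         ∎
    where
    open ≤-Reasoning
    c : ℕ
    c = a * a + b * b
    expand : ∀ a b → (a + b) * (a + b) ≡ a * a + b * b + 2 * (a * b)
    expand = solve-∀
    collect : ∀ c → c + 2 * c + c ≡ 4 * c
    collect = solve-∀


module ListCounting where

  open import Level using (0ℓ)
  open import Data.Nat
  open import Data.Nat.ListAction using (sum)
  open import Data.Nat.Properties
  open import Data.List using (List; []; _∷_; length; map; filter; downFrom)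
  open import Data.List.Membership.Propositional using (_∈_)
  open import Data.List.Relation.Unary.All as All using (All; []; _∷_)
  import Data.List.Relation.Unary.All.Properties as All
  open import Data.List.Relation.Unary.AllPairs using (AllPairs; []; _∷_)
  import Data.List.Relation.Unary.AllPairs.Properties as AllPairs
  open import Data.List.Relation.Unary.Any using (here; there)
  open import Data.List.Relation.Unary.Unique.Propositional using (Unique)
  import Data.List.Relation.Unary.Unique.Propositional.Properties as Unique
  open import Data.Product using (_×_; _,_)
  open import Data.Unit using (⊤; tt)
  open import Relation.Nullary using (yes; no; contradiction)
  open import Relation.Unary using (Pred; Decidable)
  open import Relation.Unary.Properties using (∁?)
  open import Relation.Binary.PropositionalEquality

  module _ {A : Set} where

    length-filter-split : ∀ {P : Pred A 0ℓ} (P? : Decidable P) xs →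
                          length xs ≡ length (filter P? xs) + length (filter (∁? P?) xs)
    length-filter-split P? []       = refl
    length-filter-split P? (x ∷ xs) with P? x
    ... | yes _ = cong suc (length-filter-split P? xs)
    ... | no  _ = trans (cong suc (length-filter-split P? xs)) (sym (+-suc _ _))

    length≤sum-by-key : ∀ {P : Pred A 0ℓ} (key : A → ℕ) n (bound : ℕ → ℕ) {xs} →
      Unique xs → All P xs → All (λ x → key x < n) xs →
      (∀ k {ys} → Unique ys → All (λ y → P y × key y ≡ k) ys → length ys ≤ bound k) →
      length xs ≤ sum (map bound (downFrom n))
    length≤sum-by-key key zero    bound {[]}    _ _ _         _ = z≤n
    length≤sum-by-key key zero    bound {_ ∷ _} _ _ (() ∷ _) _
    length≤sum-by-key key (suc n) bound {xs} xs! Pxs keys< fibre≤ = begin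
      length xs                                   ≡⟨ length-filter-split key≟n xs ⟩
      length (filter key≟n xs) + length (filter (∁? key≟n) xs)
        ≤⟨ +-mono-≤ (fibre≤ n (Unique.filter⁺ key≟n xs!) (All.zip (All.filter⁺ key≟n Pxs , All.all-filter key≟n xs)))
                    (length≤sum-by-key key n bound (Unique.filter⁺ (∁? key≟n) xs!) (All.filter⁺ (∁? key≟n) Pxs) keys<n fibre≤) ⟩
      bound n + sum (map bound (downFrom n))     ∎
      where
      open ≤-Reasoning
      key≟n : Decidable (λ x → key x ≡ n)
      key≟n x = key x ≟ n
      keys<n : All (λ x → key x < n) (filter (∁? key≟n) xs)
      keys<n = All.zipWith (λ (k<1+n , k≢n) → ≤∧≢⇒< (≤-pred k<1+n) k≢n)
                 (All.filter⁺ (∁? key≟n) keys< , All.all-filter (∁? key≟n) xs)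

    injectiveOn⇒unique-map : ∀ {B : Set} (f : A → B) {xs} → Unique xs →
      (∀ {x y} → x ∈ xs → y ∈ xs → f x ≡ f y → x ≡ y) → Unique (map f xs)
    injectiveOn⇒unique-map f xs! inj = AllPairs.map⁺ (distinct-images xs! inj)
      where
      distinct-images : ∀ {xs} → Unique xs → (∀ {x y} → x ∈ xs → y ∈ xs → f x ≡ f y → x ≡ y) →
                        AllPairs (λ x y → f x ≢ f y) xs
      distinct-images []          _   = []
      distinct-images (x∉ ∷ xs!) inj =
        All.tabulate (λ y∈ fx≡fy → All.lookup x∉ y∈ (inj (here refl) (there y∈) fx≡fy))
        ∷ distinct-images xs! (λ x∈ y∈ → inj (there x∈) (there y∈))

  sum-const : ∀ c n → sum (map (λ _ → c) (downFrom n)) ≡ n * c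
  sum-const c zero    = refl
  sum-const c (suc n) = cong (c +_) (sum-const c n)

  unique-bounded⇒length≤ : ∀ n {xs} → Unique xs → All (_< n) xs → length xs ≤ n
  unique-bounded⇒length≤ n {xs} xs! xs<n = begin
    length xs                               ≤⟨ length≤sum-by-key (λ x → x) n (λ _ → 1) xs! (All.tabulate (λ _ → tt)) xs<n at-most-one ⟩
    sum (map (λ _ → 1) (downFrom n))        ≡⟨ sum-const 1 n ⟩
    n * 1                                   ≡⟨ *-identityʳ n ⟩
    n                                       ∎
    where
    open ≤-Reasoning
    at-most-one : ∀ k {ys : List ℕ} → Unique ys → All (λ y → ⊤ × y ≡ k) ys → length ys ≤ 1
    at-most-one k []               _                             = z≤n
    at-most-one k (_ ∷ [])         _                             = s≤s z≤n
    at-most-one k ((y≢y′ ∷ _) ∷ _)  ((_ , refl) ∷ (_ , refl) ∷ _) = contradiction refl y≢y′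


module Divisibility where

  open import Data.Nat
  open import Data.Nat.Coprimality using (Coprime; coprime-divisor)
  import Data.Nat.Coprimality as Coprimality
  open import Data.Nat.DivMod
  open import Data.Nat.Divisibility
  open import Data.Nat.Primality using (Prime; euclidsLemma; prime⇒irreducible; prime[2])
  open import Data.Nat.Properties
  import Data.Integer as ℤ
  import Data.Integer.Divisibility.Signed as ℤ∣
  import Data.Integer.Properties as ℤP
  open import Data.Integer.Tactic.RingSolver using (solve-∀)
  open import Data.Product using (_,_)
  open import Data.Sum using (_⊎_; inj₁; inj₂; [_,_]′)
  open import Function using (id)
  open import Relation.Nullary using (¬_; yes; no; contradiction)
  open import Relation.Binary.PropositionalEquality

  private
    ∣m-n∣≡∣[+m]-[+n]∣ : ∀ m n → ∣ m - n ∣ ≡ ℤ.∣ ℤ.+ m ℤ.- ℤ.+ n ∣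
    ∣m-n∣≡∣[+m]-[+n]∣ m n with ≤-total m n
    ... | inj₁ m≤n = trans (m≤n⇒∣m-n∣≡n∸m m≤n)
                           (sym (trans (cong ℤ.∣_∣ (ℤP.[+m]-[+n]≡m⊖n m n)) (ℤP.∣⊖∣-≤ m≤n)))
    ... | inj₂ n≤m = trans (m≤n⇒∣n-m∣≡n∸m n≤m)
                           (sym (trans (cong ℤ.∣_∣ (ℤP.[+m]-[+n]≡m⊖n m n)) (trans (ℤP.∣m⊖n∣≡∣n⊖m∣ m n) (ℤP.∣⊖∣-≤ n≤m))))

    toℤ : ∀ {d} m n → d ∣ ∣ m - n ∣ → ℤ.+ d ℤ∣.∣ ℤ.+ m ℤ.- ℤ.+ n
    toℤ {d} m n d∣ = ℤ∣.∣ᵤ⇒∣ (subst (d ∣_) (∣m-n∣≡∣[+m]-[+n]∣ m n) d∣)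

    fromℤ : ∀ {d i} → ℤ.+ d ℤ∣.∣ i → d ∣ ℤ.∣ i ∣
    fromℤ = ℤ∣.∣⇒∣ᵤ

  ∣m∣n⇒∣∣m-n∣ : ∀ {d m n} → d ∣ m → d ∣ n → d ∣ ∣ m - n ∣
  ∣m∣n⇒∣∣m-n∣ {d} {m} {n} d∣m d∣n with ≤-total m n
  ... | inj₁ m≤n = subst (d ∣_) (sym (m≤n⇒∣m-n∣≡n∸m m≤n)) (∣m+n∣m⇒∣n (subst (d ∣_) (sym (m+[n∸m]≡n m≤n)) d∣n) d∣m)
  ... | inj₂ n≤m = subst (d ∣_) (sym (m≤n⇒∣n-m∣≡n∸m n≤m)) (∣m+n∣m⇒∣n (subst (d ∣_) (sym (m+[n∸m]≡n n≤m)) d∣m) d∣n)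

  ∣c+a∧∣c+b⇒∣∣a-b∣ : ∀ {d a b} c → d ∣ c + a → d ∣ c + b → d ∣ ∣ a - b ∣
  ∣c+a∧∣c+b⇒∣∣a-b∣ {d} {a} {b} c d∣c+a d∣c+b = subst (d ∣_) (∣m+n-m+o∣≡∣n-o∣ c a b) (∣m∣n⇒∣∣m-n∣ d∣c+a d∣c+b)

  ∣∣-∣-trans : ∀ {d a b c} → d ∣ ∣ a - b ∣ → d ∣ ∣ b - c ∣ → d ∣ ∣ a - c ∣
  ∣∣-∣-trans {d} {a} {b} {c} d∣a-b d∣b-c = subst (d ∣_) (sym (∣m-n∣≡∣[+m]-[+n]∣ a c))
    (fromℤ (subst (ℤ.+ d ℤ∣.∣_) (telescope (ℤ.+ a) (ℤ.+ b) (ℤ.+ c)) (ℤ∣.∣m∣n⇒∣m+n (toℤ a b d∣a-b) (toℤ b c d∣b-c))))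
    where
    telescope : ∀ x y z → (x ℤ.- y) ℤ.+ (y ℤ.- z) ≡ x ℤ.- z
    telescope = solve-∀

  ∣∣a-b∣∧∣a+b⇒∣2a : ∀ {d a b} → d ∣ ∣ a - b ∣ → d ∣ a + b → d ∣ 2 * a
  ∣∣a-b∣∧∣a+b⇒∣2a {d} {a} {b} d∣a-b d∣a+b = subst (d ∣_) (ℤP.abs-* (ℤ.+ 2) (ℤ.+ a))
    (fromℤ (subst (ℤ.+ d ℤ∣.∣_) (sum-of-difference-and-sum (ℤ.+ a) (ℤ.+ b))
      (ℤ∣.∣m∣n⇒∣m+n (toℤ a b d∣a-b) (ℤ∣.∣ᵤ⇒∣ (subst (d ∣_) (sym (cong ℤ.∣_∣ (ℤP.pos-+ a b))) d∣a+b)))))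
    where
    sum-of-difference-and-sum : ∀ x y → (x ℤ.- y) ℤ.+ (x ℤ.+ y) ≡ ℤ.+ 2 ℤ.* x
    sum-of-difference-and-sum = solve-∀

  ∣a*a-b*b∣≡∣a-b∣*[a+b] : ∀ a b → ∣ a * a - b * b ∣ ≡ ∣ a - b ∣ * (a + b)
  ∣a*a-b*b∣≡∣a-b∣*[a+b] a b = begin
    ∣ a * a - b * b ∣                                  ≡⟨ ∣m-n∣≡∣[+m]-[+n]∣ (a * a) (b * b) ⟩
    ℤ.∣ ℤ.+ (a * a) ℤ.- ℤ.+ (b * b) ∣                  ≡⟨ cong ℤ.∣_∣ (cong₂ ℤ._-_ (ℤP.pos-* a a) (ℤP.pos-* b b)) ⟩
    ℤ.∣ ℤ.+ a ℤ.* ℤ.+ a ℤ.- ℤ.+ b ℤ.* ℤ.+ b ∣          ≡⟨ cong ℤ.∣_∣ (difference-of-squares (ℤ.+ a) (ℤ.+ b)) ⟩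
    ℤ.∣ (ℤ.+ a ℤ.- ℤ.+ b) ℤ.* (ℤ.+ a ℤ.+ ℤ.+ b) ∣      ≡⟨ ℤP.abs-* (ℤ.+ a ℤ.- ℤ.+ b) (ℤ.+ a ℤ.+ ℤ.+ b) ⟩
    ℤ.∣ ℤ.+ a ℤ.- ℤ.+ b ∣ * (a + b)                    ≡⟨ cong (_* (a + b)) (sym (∣m-n∣≡∣[+m]-[+n]∣ a b)) ⟩
    ∣ a - b ∣ * (a + b)                                ∎
    where
    open ≡-Reasoning
    difference-of-squares : ∀ x y → x ℤ.* x ℤ.- y ℤ.* y ≡ (x ℤ.- y) ℤ.* (x ℤ.+ y)
    difference-of-squares = solve-∀

  m+n≡o+p⇒∣m-o∣≡∣p-n∣ : ∀ {m n o p} → m + n ≡ o + p → ∣ m - o ∣ ≡ ∣ p - n ∣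
  m+n≡o+p⇒∣m-o∣≡∣p-n∣ {m} {n} {o} {p} eq = begin
    ∣ m - o ∣                 ≡⟨ sym (∣m+n-m+o∣≡∣n-o∣ p m o) ⟩
    ∣ p + m - p + o ∣         ≡⟨ cong ∣_- p + o ∣ (+-comm p m) ⟩
    ∣ m + p - p + o ∣         ≡⟨ cong ∣ m + p -_∣ (trans (+-comm p o) (sym eq)) ⟩
    ∣ m + p - m + n ∣         ≡⟨ ∣m+n-m+o∣≡∣n-o∣ m p n ⟩
    ∣ p - n ∣                 ∎
    where open ≡-Reasoning

  ∣a*a-b*b∣≡∣d′-d∣*q : ∀ {a b d d′ q A} → a * a + d * q ≡ A → b * b + d′ * q ≡ A →
                       ∣ a * a - b * b ∣ ≡ ∣ d′ - d ∣ * q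
  ∣a*a-b*b∣≡∣d′-d∣*q {a} {b} {d} {d′} {q} eq eq′ =
    trans (m+n≡o+p⇒∣m-o∣≡∣p-n∣ {a * a} {d * q} {b * b} {d′ * q} (trans eq (sym eq′))) (sym (*-distribʳ-∣-∣ q d′ d))

  ∣m-n∣≤h∸l : ∀ {l h m n} → l ≤ m → m ≤ h → l ≤ n → n ≤ h → ∣ m - n ∣ ≤ h ∸ l
  ∣m-n∣≤h∸l {l} {h} {m} {n} l≤m m≤h l≤n n≤h with ≤-total m n
  ... | inj₁ m≤n = ≤-trans (≤-reflexive (m≤n⇒∣m-n∣≡n∸m m≤n)) (∸-mono n≤h l≤m)
  ... | inj₂ n≤m = ≤-trans (≤-reflexive (m≤n⇒∣n-m∣≡n∸m n≤m)) (∸-mono m≤h l≤n)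

  prime∣2⇒≡2 : ∀ {p} → Prime p → p ∣ 2 → p ≡ 2
  prime∣2⇒≡2 {suc (suc _)} _ p∣2 = ≤-antisym (∣⇒≤ p∣2) (s≤s (s≤s z≤n))

  prime∣m*m⇒∣m : ∀ {p m} → Prime p → p ∣ m * m → p ∣ m
  prime∣m*m⇒∣m {m = m} pp p∣m*m = [ id , id ]′ (euclidsLemma m m pp p∣m*m)

  ¬2∣⇒2∣1+ : ∀ {a} → ¬ 2 ∣ a → 2 ∣ 1 + a
  ¬2∣⇒2∣1+ {a} 2∤a with a % 2 | m≡m%n+[m/n]*n a 2 | m%n<n a 2
  ... | 0           | a≡ | _ = contradiction (divides (a / 2) a≡) 2∤a
  ... | 1           | a≡ | _ = divides (suc (a / 2)) (cong suc a≡)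
  ... | suc (suc _) | _  | s≤s (s≤s ())

  prime∤⇒coprime : ∀ {p n} → Prime p → ¬ p ∣ n → Coprime p n
  prime∤⇒coprime pp p∤n (i∣p , i∣n) with prime⇒irreducible pp i∣p
  ... | inj₁ i≡1 = i≡1
  ... | inj₂ refl = contradiction i∣n p∤n

  coprime-^ʳ : ∀ {m n} → Coprime m n → ∀ k → Coprime m (n ^ k)
  coprime-^ʳ m⊥n zero    (_ , i∣1) = ∣1⇒≡1 i∣1
  coprime-^ʳ m⊥n (suc k) {i} (i∣m , i∣nᵏ⁺¹) = coprime-^ʳ m⊥n k (i∣m , coprime-divisor i⊥n i∣nᵏ⁺¹)
    where
    i⊥n : Coprime i _
    i⊥n (j∣i , j∣n) = m⊥n (∣-trans j∣i i∣m , j∣n)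

  prime∤⇒coprime-^ : ∀ {p n} → Prime p → ¬ p ∣ n → ∀ k → Coprime (p ^ k) n
  prime∤⇒coprime-^ pp p∤n k = Coprimality.sym (coprime-^ʳ (Coprimality.sym (prime∤⇒coprime pp p∤n)) k)

  prime-power-∣-*ʳ : ∀ {p m n} k → Prime p → ¬ p ∣ m → p ^ k ∣ m * n → p ^ k ∣ n
  prime-power-∣-*ʳ k pp p∤m = coprime-divisor (prime∤⇒coprime-^ pp p∤m k)

  coprime⇒*-∣ : ∀ {m n o} → Coprime m n → m ∣ o → n ∣ o → m * n ∣ o
  coprime⇒*-∣ {m} {n} m⊥n (divides q refl) n∣qm = subst (m * n ∣_) (*-comm m q)
    (*-monoʳ-∣ m (coprime-divisor (Coprimality.sym m⊥n) (subst (n ∣_) (*-comm q m) n∣qm)))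

  square-roots-mod-odd-prime-power : ∀ {r a b} j → Prime r → r ≢ 2 → ¬ r ∣ a →
    r ^ j ∣ ∣ a * a - b * b ∣ → r ^ j ∣ ∣ a - b ∣ ⊎ r ^ j ∣ a + b
  square-roots-mod-odd-prime-power {r} {a} {b} j pr r≢2 r∤a rʲ∣ with r ∣? ∣ a - b ∣
  ... | yes r∣a-b = inj₁ (prime-power-∣-*ʳ j pr r∤a+b (subst (r ^ j ∣_) (trans (∣a*a-b*b∣≡∣a-b∣*[a+b] a b) (*-comm _ (a + b))) rʲ∣))
    where
    r∤a+b : ¬ r ∣ a + b
    r∤a+b r∣a+b with euclidsLemma 2 a pr (∣∣a-b∣∧∣a+b⇒∣2a {a = a} {b} r∣a-b r∣a+b)
    ... | inj₁ r∣2 = r≢2 (prime∣2⇒≡2 pr r∣2)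
    ... | inj₂ r∣a = r∤a r∣a
  ... | no r∤a-b = inj₂ (prime-power-∣-*ʳ j pr r∤a-b (subst (r ^ j ∣_) (∣a*a-b*b∣≡∣a-b∣*[a+b] a b) rʲ∣))

  2^[1+j]∣m*n⇒2^j∣n : ∀ {m n} j → 2 ∣ m → ¬ 4 ∣ m → 2 ^ suc j ∣ m * n → 2 ^ j ∣ n
  2^[1+j]∣m*n⇒2^j∣n {m} {n} j (divides o refl) 4∤m 2ʲ⁺¹∣ =
    prime-power-∣-*ʳ j prime[2] 2∤o (*-cancelˡ-∣ 2 (subst (2 * 2 ^ j ∣_) (trans (cong (_* n) (*-comm o 2)) (*-assoc 2 o n)) 2ʲ⁺¹∣))
    where
    2∤o : ¬ 2 ∣ o
    2∤o (divides o′ refl) = 4∤m (divides o′ (*-assoc o′ 2 2))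

  square-roots-mod-2^[1+j] : ∀ {a b} j → ¬ 2 ∣ a → ¬ 2 ∣ b →
    2 ^ suc j ∣ ∣ a * a - b * b ∣ → 2 ^ j ∣ ∣ a - b ∣ ⊎ 2 ^ j ∣ a + b
  square-roots-mod-2^[1+j] {a} {b} j 2∤a 2∤b 2ʲ⁺¹∣ with 4 ∣? ∣ a - b ∣
  ... | no 4∤a-b  = inj₂ (2^[1+j]∣m*n⇒2^j∣n j 2∣a-b 4∤a-b (subst (2 ^ suc j ∣_) (∣a*a-b*b∣≡∣a-b∣*[a+b] a b) 2ʲ⁺¹∣))
    where
    2∣a-b : 2 ∣ ∣ a - b ∣
    2∣a-b = ∣c+a∧∣c+b⇒∣∣a-b∣ 1 (¬2∣⇒2∣1+ 2∤a) (¬2∣⇒2∣1+ 2∤b)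
  ... | yes 4∣a-b = inj₁ (2^[1+j]∣m*n⇒2^j∣n j 2∣a+b 4∤a+b (subst (2 ^ suc j ∣_) (trans (∣a*a-b*b∣≡∣a-b∣*[a+b] a b) (*-comm _ (a + b))) 2ʲ⁺¹∣))
    where
    2∣a+b : 2 ∣ a + b
    2∣a+b = ∣m+n∣m⇒∣n (subst (2 ∣_) (cong suc (+-suc a b)) (∣m∣n⇒∣m+n (¬2∣⇒2∣1+ 2∤a) (¬2∣⇒2∣1+ 2∤b))) (divides 1 refl)
    4∤a+b : ¬ 4 ∣ a + b
    4∤a+b 4∣a+b with ∣∣a-b∣∧∣a+b⇒∣2a {a = a} {b} 4∣a-b 4∣a+b
    ... | divides q 2a≡4q = 2∤a (divides q (*-cancelˡ-≡ a (q * 2) 2 (trans 2a≡4q (trans (sym (*-assoc q 2 2)) (*-comm (q * 2) 2)))))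


module SignedFamilies where

  open import Data.Nat
  open import Data.Nat.Coprimality using (Coprime)
  open import Data.Nat.DivMod
  open import Data.Nat.Divisibility
  open import Data.Nat.Induction using (<-wellFounded)
  open import Data.Nat.Primality using (Prime; _Rough_; 2-rough; rough⇒≤; ∤⇒rough-suc; rough∧∣⇒rough; rough∧∣⇒prime)
  open import Data.Nat.Properties
  open import Data.Nat.Tactic.RingSolver using (solve-∀)
  open import Data.List using (List; []; _∷_; length; filter; map)
  open import Data.List.Membership.Propositional using (_∈_)
  open import Data.List.Membership.Propositional.Properties using (∈-filter⁻)
  open import Data.List.Properties using (length-map)
  import Data.List.Relation.Unary.All as All
  import Data.List.Relation.Unary.All.Properties as All
  open import Data.List.Relation.Unary.Any using (here)
  open import Data.List.Relation.Unary.Unique.Propositional using (Unique)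
  import Data.List.Relation.Unary.Unique.Propositional.Properties as Unique
  open import Data.Product using (∃₂; _×_; _,_; proj₁; proj₂)
  open import Data.Sum using (_⊎_; inj₁; inj₂)
  open import Function using (_∘_; it)
  open import Induction.WellFounded using (Acc; acc)
  open import Relation.Nullary using (¬_; yes; no; contradiction)
  open import Relation.Unary using (Decidable)
  open import Relation.Unary.Properties using (∁?)
  open import Relation.Binary.PropositionalEquality
  open Arithmetic using (0^n≡0; [m+n]^k≤2^k*o)
  open ListCounting using (length-filter-split; unique-bounded⇒length≤; injectiveOn⇒unique-map)
  open Divisibility

  factor-out : ∀ t .{{_ : NonTrivial t}} m .{{_ : NonZero m}} → ∃₂ λ k m′ → m ≡ t ^ k * m′ × ¬ t ∣ m′
  factor-out t m = go m (<-wellFounded m)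
    where
    go : ∀ m .{{_ : NonZero m}} → Acc _<_ m → ∃₂ λ k m′ → m ≡ t ^ k * m′ × ¬ t ∣ m′
    go m (acc rs) with t ∣? m
    ... | no t∤m = 0 , m , sym (+-identityʳ m) , t∤m
    ... | yes (divides q refl) with go q {{m*n≢0⇒m≢0 q}} (rs (m<m*n q t {{m*n≢0⇒m≢0 q}} (nonTrivial⇒n>1 t)))
    ... | k , m′ , refl , t∤m′ = suc k , m′ , trans (*-comm _ t) (sym (*-assoc t (t ^ k) m′)) , t∤m′

  CongruentUpToSign : ℕ → List ℕ → Set
  CongruentUpToSign m ws = ∀ {p} j → Prime p → p ^ j ∣ m → ∀ {a b} → a ∈ ws → b ∈ ws → p ^ j ∣ ∣ a - b ∣ ⊎ p ^ j ∣ a + b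

  ClassesAtMost : ℕ → ℕ → List ℕ → Set
  ClassesAtMost m c ws = ∀ {S} → Unique S → (∀ {a} → a ∈ S → a ∈ ws) → (∀ {a b} → a ∈ S → b ∈ S → m ∣ ∣ a - b ∣) → length S ≤ c

  CongruentUpToSign-restrict : ∀ {m m′ ws C} → m′ ∣ m → (∀ {a} → a ∈ C → a ∈ ws) →
    CongruentUpToSign m ws → CongruentUpToSign m′ C
  CongruentUpToSign-restrict m′∣m C⊆ws ±ws j pp pʲ∣m′ a∈ b∈ = ±ws j pp (∣-trans pʲ∣m′ m′∣m) (C⊆ws a∈) (C⊆ws b∈)

  ClassesAtMost-restrict : ∀ {q m′ c ws C} → Coprime q m′ → (∀ {a} → a ∈ C → a ∈ ws) →
    (∀ {a b} → a ∈ C → b ∈ C → q ∣ ∣ a - b ∣) → ClassesAtMost (q * m′) c ws → ClassesAtMost m′ c C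
  ClassesAtMost-restrict q⊥m′ C⊆ws q∣C classes S! S⊆C m′∣S =
    classes S! (C⊆ws ∘ S⊆C) λ a∈ b∈ → coprime⇒*-∣ q⊥m′ (q∣C (S⊆C a∈) (S⊆C b∈)) (m′∣S a∈ b∈)

  ClassesAtMost-within : ∀ m .{{_ : NonZero m}} κ {ws} →
    (∀ {a b} → a ∈ ws → b ∈ ws → m ∣ ∣ a - b ∣ → ∣ a - b ∣ ≤ κ * m) → ClassesAtMost m (suc (2 * κ)) ws
  ClassesAtMost-within m κ {ws} close {[]}         _  _    _   = z≤n
  ClassesAtMost-within m κ {ws} close {S@(a₀ ∷ _)} S! S⊆ws m∣S = begin
    length S                ≡⟨ sym (length-map index S) ⟩
    length (map index S)    ≤⟨ unique-bounded⇒length≤ (suc (2 * κ)) (injectiveOn⇒unique-map index S! index-injective)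
                                                      (All.map⁺ (All.tabulate index<)) ⟩
    suc (2 * κ)             ∎
    where
    open ≤-Reasoning
    shifted : ℕ → ℕ
    shifted a = a + κ * m ∸ a₀
    index : ℕ → ℕ
    index a = shifted a / m
    near : ∀ {a} → a ∈ S → ∣ a - a₀ ∣ ≤ κ * m
    near a∈ = close (S⊆ws a∈) (S⊆ws (here refl)) (m∣S a∈ (here refl))
    a₀≤ : ∀ {a} → a ∈ S → a₀ ≤ a + κ * m
    a₀≤ {a} a∈ = ≤-trans (m≤n+∣m-n∣ a₀ a) (+-monoʳ-≤ a (subst (_≤ κ * m) (∣-∣-comm a a₀) (near a∈)))
    m∣shifted : ∀ {a} → a ∈ S → m ∣ shifted a
    m∣shifted {a} a∈ = subst (m ∣_) (m≤n⇒∣n-m∣≡n∸m (a₀≤ a∈))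
      (∣∣-∣-trans {a = a + κ * m} {a} {a₀} (subst (m ∣_) (sym (trans (∣-∣-comm (a + κ * m) a) (∣m-m+n∣≡n a (κ * m)))) (n∣m*n κ))
                                            (m∣S a∈ (here refl)))
    index< : ∀ {a} → a ∈ S → index a < suc (2 * κ)
    index< {a} a∈ = s≤s (begin
      shifted a / m              ≤⟨ /-monoˡ-≤ m (∸-monoˡ-≤ a₀ (+-monoˡ-≤ (κ * m) a≤)) ⟩
      (a₀ + κ * m + κ * m ∸ a₀) / m  ≡⟨ cong (_/ m) (trans (cong (_∸ a₀) (+-assoc a₀ (κ * m) (κ * m))) (m+n∸m≡n a₀ _)) ⟩
      (κ * m + κ * m) / m        ≡⟨ cong (_/ m) (sym (*-distribʳ-+ m κ κ)) ⟩
      (κ + κ) * m / m            ≡⟨ m*n/n≡m (κ + κ) m ⟩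
      κ + κ                      ≡⟨ cong (κ +_) (sym (+-identityʳ κ)) ⟩
      2 * κ                      ∎)
      where
      a≤ : a ≤ a₀ + κ * m
      a≤ = ≤-trans (m≤n+∣m-n∣ a a₀) (+-monoʳ-≤ a₀ (near a∈))
    index-injective : ∀ {a b} → a ∈ S → b ∈ S → index a ≡ index b → a ≡ b
    index-injective {a} {b} a∈ b∈ index≡ = +-cancelʳ-≡ (κ * m) a b (begin-equality
      a + κ * m                  ≡⟨ sym (m∸n+n≡m (a₀≤ a∈)) ⟩
      shifted a + a₀             ≡⟨ cong (_+ a₀) (/-cancelʳ-≡ (m∣shifted a∈) (m∣shifted b∈) index≡) ⟩
      shifted b + a₀             ≡⟨ m∸n+n≡m (a₀≤ b∈) ⟩
      b + κ * m                  ∎)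

  record SignedFamily (m c : ℕ) (ws : List ℕ) : Set where
    field
      unique      : Unique ws
      ±-congruent : CongruentUpToSign m ws
      classes-≤   : ClassesAtMost m c ws

  split-at-prime-power : ∀ {t k m′ c ws w₀} → Prime t → ¬ t ∣ m′ → SignedFamily (t ^ k * m′) c ws → w₀ ∈ ws →
    ∃₂ λ C₁ C₂ → length ws ≡ length C₁ + length C₂ × SignedFamily m′ c C₁ × SignedFamily m′ c C₂
  split-at-prime-power {t} {k} {m′} {c} {ws} {w₀} pt t∤m′ F w₀∈ =
    filter near? ws , filter (∁? near?) ws , length-filter-split near? ws ,
    restrict near? near-congruent , restrict (∁? near?) far-congruent
    where
    open SignedFamily F
    q : ℕ
    q = t ^ k
    filtered : ∀ {P} (P? : Decidable P) {a} → a ∈ filter P? ws → a ∈ ws × P a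
    filtered P? = ∈-filter⁻ P? {xs = ws}
    near? : Decidable (λ w → q ∣ ∣ w - w₀ ∣)
    near? w = q ∣? ∣ w - w₀ ∣
    near-congruent : ∀ {a b} → a ∈ filter near? ws → b ∈ filter near? ws → q ∣ ∣ a - b ∣
    near-congruent {a} {b} a∈ b∈ = ∣∣-∣-trans {a = a} {w₀} {b} (proj₂ (filtered near? a∈))
                                      (subst (q ∣_) (∣-∣-comm b w₀) (proj₂ (filtered near? b∈)))
    opposite : ∀ {a} → a ∈ filter (∁? near?) ws → q ∣ w₀ + a
    opposite {a} a∈ with ±-congruent k pt (m∣m*n m′) (proj₁ (filtered (∁? near?) a∈)) w₀∈
    ... | inj₁ q∣a-w₀ = contradiction q∣a-w₀ (proj₂ (filtered (∁? near?) a∈))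
    ... | inj₂ q∣a+w₀ = subst (q ∣_) (+-comm a w₀) q∣a+w₀
    far-congruent : ∀ {a b} → a ∈ filter (∁? near?) ws → b ∈ filter (∁? near?) ws → q ∣ ∣ a - b ∣
    far-congruent a∈ b∈ = ∣c+a∧∣c+b⇒∣∣a-b∣ w₀ (opposite a∈) (opposite b∈)
    restrict : ∀ {P} (P? : Decidable P) → (∀ {a b} → a ∈ filter P? ws → b ∈ filter P? ws → q ∣ ∣ a - b ∣) →
               SignedFamily m′ c (filter P? ws)
    restrict P? q∣C = record
      { unique      = Unique.filter⁺ P? unique
      ; ±-congruent = CongruentUpToSign-restrict (n∣m*n q) (proj₁ ∘ filtered P?) ±-congruent
      ; classes-≤   = ClassesAtMost-restrict (prime∤⇒coprime-^ pt t∤m′ k) (proj₁ ∘ filtered P?) q∣C classes-≤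
      }

  module _ (B : ℕ) .{{_ : NonZero B}} where

    signed-family-constant : ℕ
    signed-family-constant = 2 ^ (B * (2 ^ B ∸ 2))

    private
      -- Splitting off a prime t multiplies the B-th power of the count by at most 2 ^ B: for t ≥ 2 ^ B this
      -- is paid for by the factor t of m, for smaller t by K t = 2 ^ B * K (1 + t).
      K : ℕ → ℕ
      K t = 2 ^ (B * (2 ^ B ∸ t))

      K-antitone : ∀ t → K (suc t) ≤ K t
      K-antitone t = ^-monoʳ-≤ 2 (*-monoʳ-≤ B (∸-monoʳ-≤ (2 ^ B) (n≤1+n t)))

      1≤K : ∀ t → 1 ≤ K t
      1≤K t = m^n>0 2 (B * (2 ^ B ∸ t))

      K≡1 : ∀ {t} → 2 ^ B ≤ t → K t ≡ 1
      K≡1 2^B≤t = trans (cong (λ e → 2 ^ (B * e)) (m≤n⇒m∸n≡0 2^B≤t)) (cong (2 ^_) (*-zeroʳ B))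

      2^B*K[1+t]≤K[t]*t^[1+k] : ∀ t k → 2 ≤ t → 2 ^ B * K (suc t) ≤ K t * t ^ suc k
      2^B*K[1+t]≤K[t]*t^[1+k] t k t≥2 with 2 ^ B ≤? t
      ... | no  2^B≰t = begin
        2 ^ B * K (suc t)                     ≡⟨ sym (^-distribˡ-+-* 2 B (B * (2 ^ B ∸ suc t))) ⟩
        2 ^ (B + B * (2 ^ B ∸ suc t))         ≡⟨ cong (2 ^_) (sym (*-suc B (2 ^ B ∸ suc t))) ⟩
        2 ^ (B * suc (2 ^ B ∸ suc t))         ≡⟨ cong (λ e → 2 ^ (B * e)) (sym (+-∸-assoc 1 (≰⇒> 2^B≰t))) ⟩
        K t                                   ≤⟨ m≤m*n (K t) (t ^ suc k) ⟩
        K t * t ^ suc k                       ∎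
        where
        open ≤-Reasoning
        instance
          tᵏ⁺¹≢0 : NonZero (t ^ suc k)
          tᵏ⁺¹≢0 = m^n≢0 t (suc k) {{>-nonZero (≤-trans (s≤s z≤n) t≥2)}}
      ... | yes 2^B≤t = begin
        2 ^ B * K (suc t)    ≡⟨ cong (2 ^ B *_) (K≡1 (m≤n⇒m≤1+n 2^B≤t)) ⟩
        2 ^ B * 1            ≡⟨ *-identityʳ (2 ^ B) ⟩
        2 ^ B                ≤⟨ 2^B≤t ⟩
        t                    ≤⟨ m≤m*n t (t ^ k) ⟩
        t ^ suc k            ≡⟨ sym (*-identityˡ (t ^ suc k)) ⟩
        1 * t ^ suc k        ≡⟨ cong (_* t ^ suc k) (sym (K≡1 2^B≤t)) ⟩
        K t * t ^ suc k      ∎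
        where
        open ≤-Reasoning
        instance
          tᵏ≢0 : NonZero (t ^ k)
          tᵏ≢0 = m^n≢0 t k {{>-nonZero (≤-trans (s≤s z≤n) t≥2)}}

      prime-power-step : ∀ {t k m′ c ws} → Prime t → 2 ≤ t → ¬ t ∣ m′ → SignedFamily (t ^ suc k * m′) c ws →
             (∀ {ws′} → SignedFamily m′ c ws′ → length ws′ ^ B ≤ K (suc t) * m′ * c ^ B) →
             length ws ^ B ≤ K t * (t ^ suc k * m′) * c ^ B
      prime-power-step {ws = []}     _ _ _ _ _ = ≤-trans (≤-reflexive (0^n≡0 B)) z≤n
      prime-power-step {t} {k} {m′} {c} {ws@(_ ∷ _)} pt t≥2 t∤m′ F bound with split-at-prime-power {k = suc k} pt t∤m′ F (here refl)
      ... | C₁ , C₂ , length≡ , F₁ , F₂ = begin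
        length ws ^ B                        ≡⟨ cong (_^ B) length≡ ⟩
        (length C₁ + length C₂) ^ B          ≤⟨ [m+n]^k≤2^k*o B (bound F₁) (bound F₂) ⟩
        2 ^ B * (K (suc t) * m′ * c ^ B)     ≡⟨ reassociate (2 ^ B) (K (suc t)) m′ (c ^ B) ⟩
        2 ^ B * K (suc t) * m′ * c ^ B       ≤⟨ *-monoˡ-≤ (c ^ B) (*-monoˡ-≤ m′ (2^B*K[1+t]≤K[t]*t^[1+k] t k t≥2)) ⟩
        K t * t ^ suc k * m′ * c ^ B         ≡⟨ cong (_* c ^ B) (*-assoc (K t) (t ^ suc k) m′) ⟩
        K t * (t ^ suc k * m′) * c ^ B       ∎
        where
        open ≤-Reasoning
        reassociate : ∀ a b c d → a * (b * c * d) ≡ a * b * c * d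
        reassociate = solve-∀

      rough-bound : ∀ m t → Acc _<_ (m + (m ∸ t)) → .{{_ : NonZero m}} → 2 ≤ t → t Rough m →
                    ∀ {c ws} → SignedFamily m c ws → length ws ^ B ≤ K t * m * c ^ B
      rough-bound 1 t _ _ _ {c} {ws} F = begin
        length ws ^ B      ≤⟨ ^-monoˡ-≤ B (classes-≤ unique (λ a∈ → a∈) (λ _ _ → 1∣ _)) ⟩
        c ^ B              ≤⟨ m≤n*m (c ^ B) (K t * 1) {{m*n≢0 (K t) 1 {{>-nonZero (1≤K t)}}}} ⟩
        K t * 1 * c ^ B    ∎
        where
        open ≤-Reasoning
        open SignedFamily F
      rough-bound m@(suc (suc _)) t (acc rs) t≥2 t-rough {c} {ws} F with t ∣? m
      ... | no t∤m = ≤-trans (rough-bound m (suc t) (rs m+[m∸1+t]<m+[m∸t]) (m≤n⇒m≤1+n t≥2) (∤⇒rough-suc t∤m t-rough) F)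
                             (*-monoˡ-≤ (c ^ B) (*-monoˡ-≤ m (K-antitone t)))
        where
        t<m : t < m
        t<m = ≤∧≢⇒< (rough⇒≤ t-rough) λ { refl → t∤m ∣-refl }
        m+[m∸1+t]<m+[m∸t] : m + (m ∸ suc t) < m + (m ∸ t)
        m+[m∸1+t]<m+[m∸t] = +-monoʳ-< m (∸-monoʳ-< (n<1+n t) t<m)
      ... | yes t∣m with factor-out t {{n>1⇒nonTrivial t≥2}} m
      ...   | zero  , m′ , m≡m′ , t∤m′ = contradiction (subst (t ∣_) (trans m≡m′ (*-identityˡ m′)) t∣m) t∤m′
      ...   | suc k , m′ , m≡tᵏ⁺¹m′ , t∤m′ = subst (λ m → length ws ^ B ≤ K t * m * c ^ B) (sym m≡tᵏ⁺¹m′)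
              (prime-power-step {t} {k} {m′} pt t≥2 t∤m′ (subst (λ m → SignedFamily m c ws) m≡tᵏ⁺¹m′ F)
                (rough-bound m′ (suc t) (rs m′-measure) (m≤n⇒m≤1+n t≥2) (∤⇒rough-suc t∤m′ (rough∧∣⇒rough t-rough m′∣m))))
        where
        pt : Prime t
        pt = rough∧∣⇒prime {{n>1⇒nonTrivial t≥2}} t-rough t∣m
        m′∣m : m′ ∣ m
        m′∣m = divides (t ^ suc k) m≡tᵏ⁺¹m′
        instance
          m′≢0 : NonZero m′
          m′≢0 = m*n≢0⇒n≢0 (t ^ suc k) {{subst NonZero m≡tᵏ⁺¹m′ it}}
        m′-measure : m′ + (m′ ∸ suc t) < m + (m ∸ t)
        m′-measure = begin-strict
          m′ + (m′ ∸ suc t)     <⟨ +-monoʳ-< m′ (m∸[1+n]<m m′ t) ⟩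
          m′ + m′               ≡⟨ cong (m′ +_) (sym (+-identityʳ m′)) ⟩
          2 * m′                ≤⟨ *-monoˡ-≤ m′ (≤-trans t≥2 (m≤m*n t (t ^ k) {{m^n≢0 t k {{>-nonZero (≤-trans (s≤s z≤n) t≥2)}}}})) ⟩
          t ^ suc k * m′        ≡⟨ sym m≡tᵏ⁺¹m′ ⟩
          m                     ≤⟨ m≤m+n m (m ∸ t) ⟩
          m + (m ∸ t)           ∎
          where
          open ≤-Reasoning
          m∸[1+n]<m : ∀ m .{{_ : NonZero m}} n → m ∸ suc n < m
          m∸[1+n]<m (suc m) n = s≤s (m∸n≤m m n)

    signed-family-length-≤ : ∀ {m c ws} .{{_ : NonZero m}} → SignedFamily m c ws →
                             length ws ^ B ≤ signed-family-constant * m * c ^ B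
    signed-family-length-≤ {m} = rough-bound m 2 (<-wellFounded _) ≤-refl 2-rough


module RootWindows where

  open import Data.Nat
  open import Data.Nat.Coprimality using (Coprime)
  open import Data.Nat.DivMod
  open import Data.Nat.Divisibility
  open import Data.Nat.Primality using (Prime; ¬prime[1]; euclidsLemma; prime[2])
  open import Data.Nat.Properties
  open import Data.Nat.Tactic.RingSolver using (solve-∀)
  open import Data.List using (length)
  open import Data.List.Membership.Propositional using (_∈_)
  open import Data.List.Relation.Unary.Unique.Propositional using (Unique)
  open import Data.Product using (∃; _×_; _,_)
  open import Data.Sum using (_⊎_; inj₁; inj₂) renaming (map to ⊎-map)
  open import Relation.Nullary using (¬_; yes; no)
  open import Relation.Binary.PropositionalEquality
  open Arithmetic using (^-distrib-*; ^-cancelʳ-≤)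
  open Divisibility
  open SignedFamilies

  -- For x = ⌊X⌋ the window [x, 2x + 1] contains every d with X ≤ d < 2X.
  record WindowRoot (x s A w : ℕ) : Set where
    constructor window-root
    field
      d        : ℕ
      x≤d      : x ≤ d
      d≤2x+1   : d ≤ 2 * x + 1
      equation : w * w + d * (s * s) ≡ A

  module _ {x s A a b : ℕ} where

    s*s∣∣a*a-b*b∣ : WindowRoot x s A a → WindowRoot x s A b → s * s ∣ ∣ a * a - b * b ∣
    s*s∣∣a*a-b*b∣ (window-root d _ _ eq) (window-root d′ _ _ eq′) = divides ∣ d′ - d ∣ (∣a*a-b*b∣≡∣d′-d∣*q {a} {b} {d} {d′} {s * s} eq eq′)

    ∣a*a-b*b∣≤[x+1]*s*s : WindowRoot x s A a → WindowRoot x s A b → ∣ a * a - b * b ∣ ≤ (x + 1) * (s * s)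
    ∣a*a-b*b∣≤[x+1]*s*s (window-root d x≤d d≤ eq) (window-root d′ x≤d′ d′≤ eq′) = begin
      ∣ a * a - b * b ∣      ≡⟨ ∣a*a-b*b∣≡∣d′-d∣*q {a} {b} {d} {d′} {s * s} eq eq′ ⟩
      ∣ d′ - d ∣ * (s * s)   ≤⟨ *-monoˡ-≤ (s * s) (∣m-n∣≤h∸l x≤d′ d′≤ x≤d d≤) ⟩
      (2 * x + 1 ∸ x) * (s * s) ≡⟨ cong (_* (s * s)) (2x+1∸x≡x+1 x) ⟩
      (x + 1) * (s * s)      ∎
      where
      open ≤-Reasoning
      2x+1∸x≡x+1 : ∀ x → 2 * x + 1 ∸ x ≡ x + 1
      2x+1∸x≡x+1 x = trans (cong (_∸ x) (+-assoc x (x + 0) 1)) (trans (cong (λ e → x + (e + 1) ∸ x) (+-identityʳ x)) (m+n∸m≡n x (x + 1)))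

  module WindowRoots {x s M : ℕ} .{{_ : NonZero s}} (s⊥M : Coprime s M) where

    Root : ℕ → Set
    Root = WindowRoot x s (4 * M)

    instance
      s*s≢0 : NonZero (s * s)
      s*s≢0 = m*n≢0 s s

    prime∣s⇒∤M : ∀ {r} → Prime r → r ∣ s → ¬ r ∣ M
    prime∣s⇒∤M pr r∣s r∣M = ¬prime[1] (subst Prime (s⊥M (r∣s , r∣M)) pr)

    odd-prime∣s⇒∤root : ∀ {r w} → Prime r → r ≢ 2 → r ∣ s → Root w → ¬ r ∣ w
    odd-prime∣s⇒∤root {r} {w} pr r≢2 r∣s (window-root d _ _ eq) r∣w
      with euclidsLemma 4 M pr (subst (r ∣_) eq (∣m∣n⇒∣m+n (∣m⇒∣m*n w r∣w) (∣n⇒∣m*n d (∣m⇒∣m*n s r∣s))))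
    ... | inj₂ r∣M = prime∣s⇒∤M pr r∣s r∣M
    ... | inj₁ r∣4 = r≢2 (prime∣2⇒≡2 pr (prime∣m*m⇒∣m pr r∣4))

    odd-prime-power : ∀ {r a b} j → Prime r → r ≢ 2 → r ^ j ∣ s * s → Root a → Root b →
                      r ^ j ∣ ∣ a - b ∣ ⊎ r ^ j ∣ a + b
    odd-prime-power zero    _  _   _     _  _  = inj₁ (1∣ _)
    odd-prime-power {r} {a} {b} (suc j) pr r≢2 rʲ⁺¹∣ ra rb =
      square-roots-mod-odd-prime-power {b = b} (suc j) pr r≢2 (odd-prime∣s⇒∤root pr r≢2 r∣s ra) (∣-trans rʲ⁺¹∣ (s*s∣∣a*a-b*b∣ ra rb))
      where
      r∣s : r ∣ s
      r∣s = prime∣m*m⇒∣m pr (∣-trans (m∣m*n (r ^ j)) rʲ⁺¹∣)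

    congruentUpToSign-odd : ∀ {ws} → ¬ 2 ∣ s → (∀ {w} → w ∈ ws → Root w) → CongruentUpToSign (s * s) ws
    congruentUpToSign-odd 2∤s roots zero    _  _  _  _  = inj₁ (1∣ _)
    congruentUpToSign-odd 2∤s roots {p} (suc j) pp pʲ⁺¹∣ a∈ b∈ = odd-prime-power (suc j) pp p≢2 pʲ⁺¹∣ (roots a∈) (roots b∈)
      where
      p≢2 : p ≢ 2
      p≢2 refl = 2∤s (prime∣m*m⇒∣m prime[2] (∣-trans (m∣m*n (2 ^ j)) pʲ⁺¹∣))

    -- Square roots of an odd number modulo 2 ^ (1 + j) agree up to sign only modulo 2 ^ j, so for even s
    -- the roots are halved and the modulus drops from s * s to h * h.
    module _ {h : ℕ} (s≡h*2 : s ≡ h * 2) where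

      private
        halve : ∀ {w} → Root w → ∃ λ w′ → w ≡ w′ * 2 × WindowRoot x h M w′
        halve {w} (window-root d x≤d d≤ eq) with prime∣m*m⇒∣m {m = w} prime[2] 2∣w*w
          where
          2∣w*w : 2 ∣ w * w
          2∣w*w = ∣m+n∣m⇒∣n (subst (2 ∣_) (trans (sym eq) (+-comm (w * w) _)) (divides (2 * M) (4M≡2M*2 M)))
                            (∣n⇒∣m*n d (∣m⇒∣m*n s (divides h s≡h*2)))
            where 4M≡2M*2 : ∀ M → 4 * M ≡ 2 * M * 2
                  4M≡2M*2 = solve-∀
        ... | divides w′ refl = w′ , refl , window-root d x≤d d≤
              (*-cancelˡ-≡ _ _ 4 (trans (quadruple w′ d h) (trans (cong (λ s → w′ * 2 * (w′ * 2) + d * (s * s)) (sym s≡h*2)) eq)))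
          where quadruple : ∀ w′ d h → 4 * (w′ * w′ + d * (h * h)) ≡ w′ * 2 * (w′ * 2) + d * (h * 2 * (h * 2))
                quadruple = solve-∀

        half-odd : ∀ {w′} → 2 ∣ h → WindowRoot x h M w′ → ¬ 2 ∣ w′
        half-odd 2∣h (window-root d _ _ eq) 2∣w′ = prime∣s⇒∤M prime[2] (divides h s≡h*2)
          (subst (2 ∣_) eq (∣m∣n⇒∣m+n (∣m⇒∣m*n _ 2∣w′) (∣n⇒∣m*n d (∣m⇒∣m*n h 2∣h))))

        double : ∀ j {a b} → 2 ^ j ∣ ∣ a - b ∣ ⊎ 2 ^ j ∣ a + b → 2 ^ suc j ∣ ∣ a * 2 - b * 2 ∣ ⊎ 2 ^ suc j ∣ a * 2 + b * 2
        double j {a} {b} = ⊎-map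
          (λ 2ʲ∣ → subst₂ _∣_ (*-comm (2 ^ j) 2) (*-distribʳ-∣-∣ 2 a b) (*-monoˡ-∣ 2 2ʲ∣))
          (λ 2ʲ∣ → subst₂ _∣_ (*-comm (2 ^ j) 2) (*-distribʳ-+ 2 a b) (*-monoˡ-∣ 2 2ʲ∣))

      power-of-two : ∀ {a b} j → 2 ^ suc j ∣ h * h → Root a → Root b → 2 ^ suc j ∣ ∣ a - b ∣ ⊎ 2 ^ suc j ∣ a + b
      power-of-two {a} {b} j 2ʲ⁺¹∣h*h ra rb with halve {a} ra | halve {b} rb
      ... | a′ , refl , ra′ | b′ , refl , rb′ =
        double j {a′} {b′} (square-roots-mod-2^[1+j] {a′} {b′} j (half-odd 2∣h ra′) (half-odd 2∣h rb′) (∣-trans 2ʲ⁺¹∣h*h (s*s∣∣a*a-b*b∣ ra′ rb′)))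
        where
        2∣h : 2 ∣ h
        2∣h = prime∣m*m⇒∣m prime[2] (∣-trans (m∣m*n (2 ^ j)) 2ʲ⁺¹∣h*h)

      congruentUpToSign-even : ∀ {ws} → (∀ {w} → w ∈ ws → Root w) → CongruentUpToSign (h * h) ws
      congruentUpToSign-even roots zero    _  _  _  _  = inj₁ (1∣ _)
      congruentUpToSign-even roots {p} (suc j) pp pʲ⁺¹∣ a∈ b∈ with p ≟ 2
      ... | yes refl = power-of-two j pʲ⁺¹∣ (roots a∈) (roots b∈)
      ... | no  p≢2  = odd-prime-power (suc j) pp p≢2 (∣-trans pʲ⁺¹∣ h*h∣s*s) (roots a∈) (roots b∈)
        where
        h*h∣s*s : h * h ∣ s * s
        h*h∣s*s = divides 4 (trans (cong (λ s → s * s) s≡h*2) (square-of-double h))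
          where square-of-double : ∀ h → h * 2 * (h * 2) ≡ 4 * (h * h)
                square-of-double = solve-∀

    module _ {y : ℕ} (x≥1 : 1 ≤ x) (y-max : ∀ t → t * t ≤ 32 * x → t ≤ y) where

      classesAtMost : ∀ {m ws} .{{_ : NonZero m}} → s * s ≤ 4 * m → (∀ {w} → w ∈ ws → Root w) →
                      ClassesAtMost m (suc (2 * (y / s))) ws
      classesAtMost {m} {ws} s*s≤4m roots = ClassesAtMost-within m (y / s) close
        where
        close : ∀ {a b} → a ∈ ws → b ∈ ws → m ∣ ∣ a - b ∣ → ∣ a - b ∣ ≤ y / s * m
        close {a} {b} a∈ b∈ (divides k ∣a-b∣≡k*m) = subst (_≤ y / s * m) (sym ∣a-b∣≡k*m) (*-monoˡ-≤ m k≤y/s)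
          where
          open ≤-Reasoning
          D : ℕ
          D = ∣ a - b ∣
          D*D≤ : D * D ≤ (x + 1) * (s * s)
          D*D≤ = begin
            D * D                  ≤⟨ *-monoʳ-≤ D (≤-trans (∣m-n∣≤m⊔n a b) (m⊔n≤m+n a b)) ⟩
            D * (a + b)            ≡⟨ sym (∣a*a-b*b∣≡∣a-b∣*[a+b] a b) ⟩
            ∣ a * a - b * b ∣      ≤⟨ ∣a*a-b*b∣≤[x+1]*s*s (roots a∈) (roots b∈) ⟩
            (x + 1) * (s * s)      ∎
          k*s≤y : k * s ≤ y
          k*s≤y = y-max (k * s) (*-cancelʳ-≤ _ _ (s * s) (begin
            k * s * (k * s) * (s * s)        ≡⟨ regroup k s ⟩
            k * k * (s * s * (s * s))        ≤⟨ *-monoʳ-≤ (k * k) (*-mono-≤ s*s≤4m s*s≤4m) ⟩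
            k * k * (4 * m * (4 * m))        ≡⟨ regroup′ k m ⟩
            16 * (k * m * (k * m))           ≡⟨ cong (λ D → 16 * (D * D)) (sym ∣a-b∣≡k*m) ⟩
            16 * (D * D)                     ≤⟨ *-monoʳ-≤ 16 D*D≤ ⟩
            16 * ((x + 1) * (s * s))         ≡⟨ sym (*-assoc 16 (x + 1) (s * s)) ⟩
            16 * (x + 1) * (s * s)           ≤⟨ *-monoˡ-≤ (s * s) 16[x+1]≤32x ⟩
            32 * x * (s * s)                 ∎))
            where
            regroup : ∀ k s → k * s * (k * s) * (s * s) ≡ k * k * (s * s * (s * s))
            regroup = solve-∀
            regroup′ : ∀ k m → k * k * (4 * m * (4 * m)) ≡ 16 * (k * m * (k * m))
            regroup′ = solve-∀
            16[x+1]≤32x : 16 * (x + 1) ≤ 32 * x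
            16[x+1]≤32x = begin
              16 * (x + 1)       ≡⟨ *-distribˡ-+ 16 x 1 ⟩
              16 * x + 16        ≤⟨ +-monoʳ-≤ (16 * x) (*-monoʳ-≤ 16 x≥1) ⟩
              16 * x + 16 * x    ≡⟨ sym (*-distribʳ-+ x 16 16) ⟩
              32 * x             ∎
          k≤y/s : k ≤ y / s
          k≤y/s = ≤-trans (≤-reflexive (sym (m*n/n≡m k s))) (/-monoˡ-≤ s k*s≤y)

      signedFamily : ∀ {ws} → Unique ws → (∀ {w} → w ∈ ws → Root w) →
                     ∃ λ m → NonZero m × m ≤ s * s × SignedFamily m (suc (2 * (y / s))) ws
      signedFamily ws! roots with 2 ∣? s
      ... | no 2∤s = s * s , s*s≢0 , ≤-refl , record
        { unique = ws! ; ±-congruent = congruentUpToSign-odd 2∤s roots ; classes-≤ = classesAtMost (m≤n*m (s * s) 4) roots }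
      ... | yes (divides h s≡h*2) = h * h , h*h≢0 , h*h≤s*s , record
        { unique = ws! ; ±-congruent = congruentUpToSign-even {h} s≡h*2 roots ; classes-≤ = classesAtMost {{h*h≢0}} (≤-reflexive s*s≡4*h*h) roots }
        where
        s*s≡4*h*h : s * s ≡ 4 * (h * h)
        s*s≡4*h*h = trans (cong (λ s → s * s) s≡h*2) (square-of-double h)
          where square-of-double : ∀ h → h * 2 * (h * 2) ≡ 4 * (h * h)
                square-of-double = solve-∀
        h*h≢0 : NonZero (h * h)
        h*h≢0 = m*n≢0⇒n≢0 4 {{subst NonZero s*s≡4*h*h s*s≢0}}
        h*h≤s*s : h * h ≤ s * s
        h*h≤s*s = subst (h * h ≤_) (sym s*s≡4*h*h) (m≤n*m (h * h) 4)

      window-roots-length-≤ : ∀ B .{{_ : NonZero B}} {ws S ρ} → Unique ws → (∀ {w} → w ∈ ws → Root w) → s ≤ S →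
                              signed-family-constant B * (S * S) ≤ ρ ^ B → length ws ≤ ρ * suc (2 * (y / s))
      window-roots-length-≤ B {ws} {S} {ρ} ws! roots s≤S K*S*S≤ρᴮ with signedFamily ws! roots
      ... | m , m≢0 , m≤s*s , F = ^-cancelʳ-≤ B (begin
        length ws ^ B                                     ≤⟨ signed-family-length-≤ B F ⟩
        signed-family-constant B * m * c ^ B              ≤⟨ *-monoˡ-≤ (c ^ B) (*-monoʳ-≤ (signed-family-constant B) (≤-trans m≤s*s (*-mono-≤ s≤S s≤S))) ⟩
        signed-family-constant B * (S * S) * c ^ B        ≤⟨ *-monoˡ-≤ (c ^ B) K*S*S≤ρᴮ ⟩
        ρ ^ B * c ^ B                                     ≡⟨ sym (^-distrib-* ρ c B) ⟩
        (ρ * c) ^ B                                       ∎)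
        where
        open ≤-Reasoning
        c : ℕ
        c = suc (2 * (y / s))
        instance
          m-nonZero : NonZero m
          m-nonZero = m≢0


module SolutionCounting where

  open import Data.Nat
  open import Data.Nat.Coprimality using (Coprime)
  open import Data.Nat.DivMod
  open import Data.Nat.ListAction using (sum)
  open import Data.Nat.Properties
  open import Data.Nat.Tactic.RingSolver using (solve-∀)
  open import Data.List using (List; []; _∷_; length; map; downFrom)
  open import Data.List.Membership.Propositional using (_∈_)
  open import Data.List.Membership.Propositional.Properties using (∈-map⁻)
  open import Data.List.Properties using (length-map)
  open import Data.List.Relation.Unary.All as All using (All; []; _∷_)
  open import Data.List.Relation.Unary.Any using (here)
  open import Data.List.Relation.Unary.Unique.Propositional using (Unique)
  import Data.List.Relation.Unary.Unique.Propositional.Properties as Unique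
  open import Data.Product using (∃; ∃₂; _×_; _,_; proj₁; proj₂)
  open import Data.Unit using (tt)
  open import Function using (_∘_)
  open import Relation.Binary.PropositionalEquality hiding (J)
  open Arithmetic
  open ListCounting
  open Divisibility using (coprime-^ʳ)
  open SignedFamilies using (signed-family-constant)
  open RootWindows

  record Solution : Set where
    constructor solution
    field
      d p p′ w v : ℕ

  record IsSolution (g x z : ℕ) (e : Solution) : Set where
    open Solution e
    field
      x≤d      : x ≤ d
      d≤2x+1   : d ≤ 2 * x + 1
      p<z      : p < z
      p′<z     : p′ < z
      v≢0      : NonZero v
      coprime  : Coprime v (p * p′)
      equation : w * w + d * (v * v) ≡ 4 * (p * p′) ^ g

  triple : Solution → ℕ × ℕ × ℕ
  triple (solution d p p′ _ _) = d , p , p′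

  HasSolution : ℕ → ℕ → ℕ → ℕ × ℕ × ℕ → Set
  HasSolution g x z (d , p , p′) = ∃₂ λ w v → IsSolution g x z (solution d p p′ w v)

  solutions-of : ∀ {g x z L} → All (HasSolution g x z) L → ∃ λ sols → map triple sols ≡ L × All (IsSolution g x z) sols
  solutions-of []                           = [] , refl , []
  solutions-of (_∷_ {d , p , p′} (w , v , ok) L-ok) with solutions-of L-ok
  ... | sols , refl , sols-ok = solution d p p′ w v ∷ sols , refl , ok ∷ sols-ok

  sum-harmonic : ∀ ρ y n → sum (map (λ k → ρ * suc (2 * (y / suc k))) (downFrom n)) ≡ ρ * (n + 2 * harmonic y n)
  sum-harmonic ρ y zero    = sym (*-zeroʳ ρ)
  sum-harmonic ρ y (suc n) = trans (cong (ρ * suc (2 * (y / suc n)) +_) (sum-harmonic ρ y n)) (regroup ρ (y / suc n) n (harmonic y n))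
    where
    regroup : ∀ ρ a n h → ρ * suc (2 * a) + ρ * (n + 2 * h) ≡ ρ * (suc n + 2 * (a + h))
    regroup = solve-∀

  square-count-≤ : ∀ {n z R S y x q} → n ≤ z * z * R * (S + 2 * y) → S * S * x ≤ 4 * (q * q) → y * y ≤ 32 * x →
                   n * n * x ≤ 512 * (R * R) * ((z * z * x + q * (z * z)) * (z * z * x + q * (z * z)))
  square-count-≤ {n} {z} {R} {S} {y} {x} {q} n≤ S*S*x≤ y*y≤ = begin
    n * n * x                                         ≤⟨ *-monoˡ-≤ x (*-mono-≤ n≤ n≤) ⟩
    M * M * x                                         ≡⟨ regroup z R S y x ⟩
    z * z * R * (z * z * R) * ((S + 2 * y) * (S + 2 * y) * x) ≤⟨ *-monoʳ-≤ (z * z * R * (z * z * R)) window ⟩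
    z * z * R * (z * z * R) * (512 * (q * q + x * x)) ≡⟨ regroup′ z R q x ⟩
    512 * (R * R) * (u * u + v * v)                   ≤⟨ *-monoʳ-≤ (512 * (R * R)) (u²+v²≤[u+v]² u v) ⟩
    512 * (R * R) * ((u + v) * (u + v))               ∎
    where
    open ≤-Reasoning
    M u v : ℕ
    M = z * z * R * (S + 2 * y)
    u = z * z * x
    v = q * (z * z)
    regroup : ∀ z R S y x → (z * z * R * (S + 2 * y)) * (z * z * R * (S + 2 * y)) * x
                            ≡ z * z * R * (z * z * R) * ((S + 2 * y) * (S + 2 * y) * x)
    regroup = solve-∀
    regroup′ : ∀ z R q x → z * z * R * (z * z * R) * (512 * (q * q + x * x))
                           ≡ 512 * (R * R) * (z * z * x * (z * z * x) + q * (z * z) * (q * (z * z)))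
    regroup′ = solve-∀
    u²+v²≤[u+v]² : ∀ u v → u * u + v * v ≤ (u + v) * (u + v)
    u²+v²≤[u+v]² u v = ≤-trans (m≤m+n (u * u + v * v) (2 * (u * v))) (≤-reflexive (expand u v))
      where expand : ∀ u v → u * u + v * v + 2 * (u * v) ≡ (u + v) * (u + v)
            expand = solve-∀
    window : (S + 2 * y) * (S + 2 * y) * x ≤ 512 * (q * q + x * x)
    window = begin
      (S + 2 * y) * (S + 2 * y) * x                ≤⟨ *-monoˡ-≤ x ([a+b]²≤4[a²+b²] S (2 * y)) ⟩
      4 * (S * S + 2 * y * (2 * y)) * x            ≡⟨ distribute S y x ⟩
      4 * (S * S * x) + 16 * (y * y) * x           ≤⟨ +-mono-≤ (*-monoʳ-≤ 4 S*S*x≤) (*-monoˡ-≤ x (*-monoʳ-≤ 16 y*y≤)) ⟩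
      4 * (4 * (q * q)) + 16 * (32 * x) * x        ≡⟨ collect q x ⟩
      16 * (q * q) + 512 * (x * x)                 ≤⟨ +-monoˡ-≤ (512 * (x * x)) (*-monoˡ-≤ (q * q) (≤ᵇ⇒≤ 16 512 tt)) ⟩
      512 * (q * q) + 512 * (x * x)                ≡⟨ sym (*-distribˡ-+ 512 (q * q) (x * x)) ⟩
      512 * (q * q + x * x)                        ∎
      where
      distribute : ∀ S y x → 4 * (S * S + 2 * y * (2 * y)) * x ≡ 4 * (S * S * x) + 16 * (y * y) * x
      distribute = solve-∀
      collect : ∀ q x → 4 * (4 * (q * q)) + 16 * (32 * x) * x ≡ 16 * (q * q) + 512 * (x * x)
      collect = solve-∀

  -- S ≈ √(Q / x) bounds v, y ≈ √(32 x) bounds the spread of a residue class of roots, and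
  -- ρ ≈ (K (1 + S)²)^(1/B) bounds the number of residue classes met by a fibre.
  module Counting (g x z B : ℕ) .{{_ : NonZero x}} .{{_ : NonZero B}} where

    Q : ℕ
    Q = 4 * (z ^ g * z ^ g)

    opaque
      S : ℕ
      S = proj₁ (greatest-square-multiple x Q)

      S*S*x≤Q : S * S * x ≤ Q
      S*S*x≤Q = proj₁ (proj₂ (greatest-square-multiple x Q))

      S-max : ∀ t → t * t * x ≤ Q → t ≤ S
      S-max = proj₂ (proj₂ (greatest-square-multiple x Q))

    opaque
      y : ℕ
      y = proj₁ (greatest-square-multiple 1 (32 * x))

      y*y≤32x : y * y ≤ 32 * x
      y*y≤32x = subst (_≤ 32 * x) (*-identityʳ (y * y)) (proj₁ (proj₂ (greatest-square-multiple 1 (32 * x))))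

      y-max : ∀ t → t * t ≤ 32 * x → t ≤ y
      y-max t t*t≤ = proj₂ (proj₂ (greatest-square-multiple 1 (32 * x))) t (subst (_≤ 32 * x) (sym (*-identityʳ (t * t))) t*t≤)

    private
      instance
        K*[1+S]²≢0 : NonZero (signed-family-constant B * (suc S * suc S))
        K*[1+S]²≢0 = m*n≢0 (signed-family-constant B) (suc S * suc S) {{m^n≢0 2 (B * (2 ^ B ∸ 2))}}

    opaque
      ρ : ℕ
      ρ = proj₁ (approximate-root B (signed-family-constant B * (suc S * suc S)))

      K*[1+S]²≤ρᴮ : signed-family-constant B * (suc S * suc S) ≤ ρ ^ B
      K*[1+S]²≤ρᴮ = proj₁ (proj₂ (approximate-root B (signed-family-constant B * (suc S * suc S))))

      ρᴮ≤2ᴮ*K*[1+S]² : ρ ^ B ≤ 2 ^ B * (signed-family-constant B * (suc S * suc S))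
      ρᴮ≤2ᴮ*K*[1+S]² = proj₂ (proj₂ (approximate-root B (signed-family-constant B * (suc S * suc S))))

    v≤S : ∀ {e} → IsSolution g x z e → Solution.v e ≤ S
    v≤S {solution d p p′ w v} ok = S-max v (begin
      v * v * x            ≤⟨ *-monoʳ-≤ (v * v) x≤d ⟩
      v * v * d            ≡⟨ *-comm (v * v) d ⟩
      d * (v * v)          ≤⟨ m≤n+m (d * (v * v)) (w * w) ⟩
      w * w + d * (v * v)  ≡⟨ equation ⟩
      4 * (p * p′) ^ g     ≡⟨ cong (4 *_) (^-distrib-* p p′ g) ⟩
      4 * (p ^ g * p′ ^ g) ≤⟨ *-monoʳ-≤ 4 (*-mono-≤ (^-monoˡ-≤ g (<⇒≤ p<z)) (^-monoˡ-≤ g (<⇒≤ p′<z))) ⟩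
      Q                    ∎)
      where
      open ≤-Reasoning
      open IsSolution ok

    record FibreMember (p₀ p₁ s : ℕ) (e : Solution) : Set where
      open Solution e
      field
        shape    : e ≡ solution d p₀ p₁ w s
        x≤d      : x ≤ d
        d≤2x+1   : d ≤ 2 * x + 1
        equation : w * w + d * (s * s) ≡ 4 * (p₀ * p₁) ^ g
        coprime  : Coprime s (p₀ * p₁)

      root : WindowRoot x s (4 * (p₀ * p₁) ^ g) w
      root = window-root d x≤d d≤2x+1 equation

    fibre-member : ∀ {p₀ p₁ v₀} e →
      ((IsSolution g x z e × Solution.p e ≡ p₀) × Solution.p′ e ≡ p₁) × pred (Solution.v e) ≡ v₀ →
      FibreMember p₀ p₁ (suc v₀) e
    fibre-member (solution d p p′ w v) (((ok , refl) , refl) , refl) = record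
      { shape    = cong (solution d p p′ w) v≡
      ; x≤d      = x≤d
      ; d≤2x+1   = d≤2x+1
      ; equation = subst (λ v → w * w + d * (v * v) ≡ 4 * (p * p′) ^ g) v≡ equation
      ; coprime  = subst (λ v → Coprime v (p * p′)) v≡ coprime
      }
      where
      open IsSolution ok
      v≡ : v ≡ suc (pred v)
      v≡ = sym (suc-pred v {{v≢0}})

    fibre-length-≤ : ∀ p₀ p₁ v₀ {ys} → Unique ys →
      All (λ e → ((IsSolution g x z e × Solution.p e ≡ p₀) × Solution.p′ e ≡ p₁) × pred (Solution.v e) ≡ v₀) ys →
      length ys ≤ ρ * suc (2 * (y / suc v₀))
    fibre-length-≤ p₀ p₁ v₀ {[]}          _   _     = z≤n
    fibre-length-≤ p₀ p₁ v₀ {ys@(_ ∷ _)} ys! ys-ok = begin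
      length ys                     ≡⟨ sym (length-map Solution.w ys) ⟩
      length (map Solution.w ys)    ≤⟨ window-roots-length-≤ (>-nonZero⁻¹ x) y-max B
                                         (injectiveOn⇒unique-map Solution.w ys! w-injective) roots 1+v₀≤1+S K*[1+S]²≤ρᴮ ⟩
      ρ * suc (2 * (y / suc v₀))    ∎
      where
      open ≤-Reasoning
      member : ∀ {e} → e ∈ ys → FibreMember p₀ p₁ (suc v₀) e
      member {e} e∈ = fibre-member e (All.lookup ys-ok e∈)
      open WindowRoots (coprime-^ʳ (FibreMember.coprime (member (here refl))) g)
      roots : ∀ {w} → w ∈ map Solution.w ys → Root w
      roots w∈ with ∈-map⁻ Solution.w w∈
      ... | e , e∈ , refl = FibreMember.root (member e∈)
      w-injective : ∀ {e e′} → e ∈ ys → e′ ∈ ys → Solution.w e ≡ Solution.w e′ → e ≡ e′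
      w-injective {e} {e′} e∈ e′∈ w≡ = trans (FibreMember.shape (member e∈))
        (trans (cong₂ (λ d w → solution d p₀ p₁ w (suc v₀)) d≡ w≡) (sym (FibreMember.shape (member e′∈))))
        where
        d≡ : Solution.d e ≡ Solution.d e′
        d≡ = *-cancelʳ-≡ _ _ (suc v₀ * suc v₀) (+-cancelˡ-≡ (Solution.w e * Solution.w e) _ _
               (trans (FibreMember.equation (member e∈))
                      (trans (sym (FibreMember.equation (member e′∈))) (cong (λ w → w * w + _) (sym w≡)))))
      1+v₀≤1+S : suc v₀ ≤ suc S
      1+v₀≤1+S with All.lookup ys-ok (here refl)
      ... | ((ok , _) , _) , pred-v≡v₀ = subst (λ k → suc k ≤ suc S) pred-v≡v₀ (s≤s (≤-trans (pred-mono-≤ (v≤S ok)) pred[n]≤n))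

    solutions-length-≤-harmonic : ∀ {sols} → Unique sols → All (IsSolution g x z) sols →
                                  length sols ≤ z * (z * (ρ * (S + 2 * harmonic y S)))
    solutions-length-≤-harmonic {sols} sols! sols-ok = begin
      length sols                             ≤⟨ length≤sum-by-key Solution.p z (λ _ → z * V) sols! sols-ok
                                                   (All.map IsSolution.p<z sols-ok) by-p′ ⟩
      sum (map (λ _ → z * V) (downFrom z))    ≡⟨ sum-const (z * V) z ⟩
      z * (z * V)                             ∎
      where
      open ≤-Reasoning
      V : ℕ
      V = ρ * (S + 2 * harmonic y S)
      by-v : ∀ p₀ p₁ {ys} → Unique ys → All (λ e → (IsSolution g x z e × Solution.p e ≡ p₀) × Solution.p′ e ≡ p₁) ys →
             length ys ≤ V
      by-v p₀ p₁ ys! ys-ok = ≤-trans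
        (length≤sum-by-key (pred ∘ Solution.v) S (λ v₀ → ρ * suc (2 * (y / suc v₀))) ys! ys-ok
          (All.map (λ ((ok , _) , _) → pred-v<S ok) ys-ok) (fibre-length-≤ p₀ p₁))
        (≤-reflexive (sum-harmonic ρ y S))
        where
        pred-v<S : ∀ {e} → IsSolution g x z e → pred (Solution.v e) < S
        pred-v<S {e} ok = subst (_≤ S) (sym (suc-pred (Solution.v e) {{IsSolution.v≢0 ok}})) (v≤S ok)
      by-p′ : ∀ p₀ {ys} → Unique ys → All (λ e → IsSolution g x z e × Solution.p e ≡ p₀) ys → length ys ≤ z * V
      by-p′ p₀ ys! ys-ok = ≤-trans
        (length≤sum-by-key Solution.p′ z (λ _ → V) ys! ys-ok (All.map (IsSolution.p′<z ∘ proj₁) ys-ok) (by-v p₀))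
        (≤-reflexive (sum-const V z))

    opaque
      J : ℕ
      J = proj₁ (dyadic-interval (suc S))

      2^J≤1+S : 2 ^ J ≤ suc S
      2^J≤1+S = proj₁ (proj₂ (dyadic-interval (suc S)))

      1+S<2^[1+J] : suc S < 2 ^ suc J
      1+S<2^[1+J] = proj₂ (proj₂ (dyadic-interval (suc S)))

    R : ℕ
    R = ρ * suc J

    solutions-length-≤ : ∀ {sols} → Unique sols → All (IsSolution g x z) sols →
                          length sols ≤ z * z * R * (S + 2 * y)
    solutions-length-≤ {sols} sols! sols-ok = begin
      length sols                                           ≤⟨ solutions-length-≤-harmonic sols! sols-ok ⟩
      z * (z * (ρ * (S + 2 * harmonic y S)))                ≤⟨ *-monoʳ-≤ z (*-monoʳ-≤ z (*-monoʳ-≤ ρ (+-mono-≤ (m≤m+n S (J * S))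
                                                                 (*-monoʳ-≤ 2 (harmonic-≤ y (suc J) (<-trans (n<1+n S) 1+S<2^[1+J])))))) ⟩
      z * (z * (ρ * (suc J * S + 2 * (suc J * y))))         ≡⟨ regroup z ρ J S y ⟩
      z * z * R * (S + 2 * y)                               ∎
      where
      open ≤-Reasoning
      regroup : ∀ z ρ J S y → z * (z * (ρ * ((S + J * S) + 2 * ((1 + J) * y)))) ≡ z * z * (ρ * (1 + J)) * (S + 2 * y)
      regroup = solve-∀

    Rᴮ≤ : z ≤ 6 * x → R ^ B ≤ 2 ^ B * signed-family-constant B * B ^ B * 125 * (36 * (x * x)) ^ (3 * g)
    Rᴮ≤ z≤6x = begin
      R ^ B                                                        ≡⟨ ^-distrib-* ρ (suc J) B ⟩
      ρ ^ B * suc J ^ B                                            ≤⟨ *-mono-≤ ρᴮ≤2ᴮ*K*[1+S]² (≤-trans ([1+n]^m≤m^m*2^n B J) (*-monoʳ-≤ (B ^ B) 2^J≤1+S)) ⟩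
      2 ^ B * (K * (suc S * suc S)) * (B ^ B * suc S)             ≡⟨ regroup (2 ^ B) K (B ^ B) (suc S) ⟩
      2 ^ B * K * B ^ B * (suc S * suc S * suc S)                  ≤⟨ *-monoʳ-≤ (2 ^ B * K * B ^ B) (*-mono-≤ (*-mono-≤ 1+S≤5T 1+S≤5T) 1+S≤5T) ⟩
      2 ^ B * K * B ^ B * (5 * T * (5 * T) * (5 * T))             ≡⟨ regroup′ (2 ^ B * K * B ^ B) T ⟩
      2 ^ B * K * B ^ B * 125 * (T * T * T)                        ≡⟨ cong (2 ^ B * K * B ^ B * 125 *_) (cube (36 * (x * x)) g) ⟩
      2 ^ B * K * B ^ B * 125 * (36 * (x * x)) ^ (3 * g)           ∎
      where
      open ≤-Reasoning
      K T : ℕ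
      K = signed-family-constant B
      T = (36 * (x * x)) ^ g
      regroup : ∀ a k b s → a * (k * (s * s)) * (b * s) ≡ a * k * b * (s * s * s)
      regroup = solve-∀
      regroup′ : ∀ c t → c * (5 * t * (5 * t) * (5 * t)) ≡ c * 125 * (t * t * t)
      regroup′ = solve-∀
      cube : ∀ a g → a ^ g * a ^ g * a ^ g ≡ a ^ (3 * g)
      cube a g = begin-equality
        a ^ g * a ^ g * a ^ g         ≡⟨ cong (_* a ^ g) (sym (^-distribˡ-+-* a g g)) ⟩
        a ^ (g + g) * a ^ g           ≡⟨ sym (^-distribˡ-+-* a (g + g) g) ⟩
        a ^ (g + g + g)               ≡⟨ cong (a ^_) (three-times g) ⟩
        a ^ (3 * g)                   ∎
        where three-times : ∀ g → g + g + g ≡ 3 * g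
              three-times = solve-∀
      1≤T : 1 ≤ T
      1≤T = m^n>0 (36 * (x * x)) {{m*n≢0 36 (x * x) {{_}} {{m*n≢0 x x}}}} g
      S≤Q : S ≤ Q
      S≤Q = ≤-trans (n≤n*n*x S) S*S*x≤Q
        where n≤n*n*x : ∀ n → n ≤ n * n * x
              n≤n*n*x zero    = z≤n
              n≤n*n*x (suc n) = ≤-trans (m≤m*n (suc n) (suc n)) (m≤m*n (suc n * suc n) x)
      Q≤4T : Q ≤ 4 * T
      Q≤4T = *-monoʳ-≤ 4 (begin
        z ^ g * z ^ g          ≡⟨ sym (^-distrib-* z z g) ⟩
        (z * z) ^ g            ≤⟨ ^-monoˡ-≤ g (≤-trans (*-mono-≤ z≤6x z≤6x) (≤-reflexive (six-squared x))) ⟩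
        (36 * (x * x)) ^ g     ∎)
        where six-squared : ∀ x → 6 * x * (6 * x) ≡ 36 * (x * x)
              six-squared = solve-∀
      1+S≤5T : suc S ≤ 5 * T
      1+S≤5T = begin
        suc S          ≤⟨ s≤s (≤-trans S≤Q Q≤4T) ⟩
        suc (4 * T)    ≤⟨ +-monoˡ-≤ (4 * T) 1≤T ⟩
        5 * T          ∎

  solutions-bound : ∀ g b .{{_ : NonZero g}} .{{_ : NonZero b}} → ∃ λ D →
    ∀ x z .{{_ : NonZero x}} → z ≤ 6 * x → ∀ {sols} → Unique sols → All (IsSolution g x z) sols →
    length sols ^ (2 * b) * x ^ b ≤ D ^ (2 * b) * (x * x) * (z ^ 2 * x + z ^ (g + 2)) ^ (2 * b)
  solutions-bound g b = 512 * (c * 36) , bound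
    where
    B : ℕ
    B = 2 * b * (3 * g)
    instance
      B≢0 : NonZero B
      B≢0 = m*n≢0 (2 * b) (3 * g) {{m*n≢0 2 b}} {{m*n≢0 3 g}}
    c : ℕ
    c = 2 ^ B * signed-family-constant B * B ^ B * 125
    bound : ∀ x z .{{_ : NonZero x}} → z ≤ 6 * x → ∀ {sols} → Unique sols → All (IsSolution g x z) sols →
            length sols ^ (2 * b) * x ^ b ≤ (512 * (c * 36)) ^ (2 * b) * (x * x) * (z ^ 2 * x + z ^ (g + 2)) ^ (2 * b)
    bound x z z≤6x {sols} sols! sols-ok = begin
      n ^ (2 * b) * x ^ b                          ≡⟨ cong (_* x ^ b) (sym ([m*m]^k≡m^[2k] n b)) ⟩
      (n * n) ^ b * x ^ b                          ≡⟨ sym (^-distrib-* (n * n) x b) ⟩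
      (n * n * x) ^ b                              ≤⟨ ^-monoˡ-≤ b (square-count-≤ {n} {z} {R} {S} {y} {x} {z ^ g}
                                                      (solutions-length-≤ sols! sols-ok) S*S*x≤Q y*y≤32x) ⟩
      (512 * (R * R) * (W * W)) ^ b                ≡⟨ expand ⟩
      512 ^ b * R ^ (2 * b) * W ^ (2 * b)          ≤⟨ *-monoˡ-≤ (W ^ (2 * b)) (*-monoʳ-≤ (512 ^ b) R²ᵇ≤) ⟩
      512 ^ b * (c * 36 * (x * x)) * W ^ (2 * b)   ≡⟨ cong (_* W ^ (2 * b)) (sym (*-assoc (512 ^ b) (c * 36) (x * x))) ⟩
      512 ^ b * (c * 36) * (x * x) * W ^ (2 * b)   ≤⟨ *-monoˡ-≤ (W ^ (2 * b)) (*-monoˡ-≤ (x * x) constant≤) ⟩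
      (512 * (c * 36)) ^ (2 * b) * (x * x) * W ^ (2 * b)                      ≡⟨ cong (λ w → (512 * (c * 36)) ^ (2 * b) * (x * x) * w ^ (2 * b)) W≡ ⟩
      (512 * (c * 36)) ^ (2 * b) * (x * x) * (z ^ 2 * x + z ^ (g + 2)) ^ (2 * b) ∎
      where
      open ≤-Reasoning
      open Counting g x z B
      n : ℕ
      n = length sols
      W : ℕ
      W = z * z * x + z ^ g * (z * z)
      W≡ : W ≡ z ^ 2 * x + z ^ (g + 2)
      W≡ = cong₂ _+_ (cong (λ t → t * x) z*z≡z²) (trans (cong (z ^ g *_) z*z≡z²) (sym (^-distribˡ-+-* z g 2)))
        where z*z≡z² : z * z ≡ z ^ 2
              z*z≡z² = cong (z *_) (sym (*-identityʳ z))
      constant≤ : 512 ^ b * (c * 36) ≤ (512 * (c * 36)) ^ (2 * b)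
      constant≤ = begin
        512 ^ b * (c * 36)                     ≤⟨ *-mono-≤ (^-monoʳ-≤ 512 (m≤n*m b 2)) (m≤m^n (c * 36) (2 * b) {{m*n≢0 2 b}}) ⟩
        512 ^ (2 * b) * (c * 36) ^ (2 * b)     ≡⟨ sym (^-distrib-* 512 (c * 36) (2 * b)) ⟩
        (512 * (c * 36)) ^ (2 * b)             ∎
      expand : (512 * (R * R) * (W * W)) ^ b ≡ 512 ^ b * R ^ (2 * b) * W ^ (2 * b)
      expand = begin-equality
        (512 * (R * R) * (W * W)) ^ b              ≡⟨ ^-distrib-* (512 * (R * R)) (W * W) b ⟩
        (512 * (R * R)) ^ b * (W * W) ^ b          ≡⟨ cong (_* (W * W) ^ b) (^-distrib-* 512 (R * R) b) ⟩
        512 ^ b * (R * R) ^ b * (W * W) ^ b        ≡⟨ cong₂ (λ r w → 512 ^ b * r * w) ([m*m]^k≡m^[2k] R b) ([m*m]^k≡m^[2k] W b) ⟩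
        512 ^ b * R ^ (2 * b) * W ^ (2 * b)        ∎
      R²ᵇ≤ : R ^ (2 * b) ≤ c * 36 * (x * x)
      R²ᵇ≤ = ^-cancelʳ-≤ (3 * g) (begin
        (R ^ (2 * b)) ^ (3 * g)                    ≡⟨ ^-*-assoc R (2 * b) (3 * g) ⟩
        R ^ B                                      ≤⟨ Rᴮ≤ z≤6x ⟩
        c * (36 * (x * x)) ^ (3 * g)               ≤⟨ *-monoˡ-≤ ((36 * (x * x)) ^ (3 * g)) (m≤m^n c (3 * g)) ⟩
        c ^ (3 * g) * (36 * (x * x)) ^ (3 * g)     ≡⟨ sym (^-distrib-* c (36 * (x * x)) (3 * g)) ⟩
        (c * (36 * (x * x))) ^ (3 * g)             ≡⟨ cong (_^ (3 * g)) (sym (*-assoc c 36 (x * x))) ⟩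
        (c * 36 * (x * x)) ^ (3 * g)               ∎)
        where instance _ = m*n≢0 3 g

  triples-bound : ∀ g b .{{_ : NonZero g}} .{{_ : NonZero b}} → ∃ λ D →
    ∀ x z .{{_ : NonZero x}} → z ≤ 6 * x → ∀ {L} → Unique L → All (HasSolution g x z) L →
    length L ^ (2 * b) * x ^ b ≤ D ^ (2 * b) * (x * x) * (z ^ 2 * x + z ^ (g + 2)) ^ (2 * b)
  triples-bound g b = proj₁ (solutions-bound g b) , λ x z z≤6x L! L-ok →
    via-solutions {k = 2 * b} (proj₂ (solutions-bound g b) x z z≤6x) L! (solutions-of L-ok)
    where
    via-solutions : ∀ {x z k r L} → (∀ {sols} → Unique sols → All (IsSolution g x z) sols → length sols ^ k * x ^ b ≤ r) →
                    Unique L → (∃ λ sols → map triple sols ≡ L × All (IsSolution g x z) sols) → length L ^ k * x ^ b ≤ r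
    via-solutions {x} {k = k} {r} bound L! (sols , refl , sols-ok) =
      subst (λ n → n ^ k * x ^ b ≤ r) (sym (length-map triple sols)) (bound (Unique.map⁻ L!) sols-ok)


module RationalBounds where

  open import Data.Nat as ℕ using (ℕ; zero; suc)
  import Data.Nat.Coprimality as Coprimality
  import Data.Nat.DivMod as ℕ
  import Data.Nat.Properties as ℕ
  open import Data.Nat.Tactic.RingSolver using (solve-∀)
  open import Data.Integer as ℤ using (+_; -[1+_])
  import Data.Integer.Properties as ℤ
  open import Data.Rational using (ℚ; mkℚ; _+_; _*_; _/_; _≤_; _<_; 0ℚ; 1ℚ; nonNegative; *≤*; *<*; ↥_; ↧ₙ_)
  import Data.Rational.Properties as ℚ
  open import Data.Rational.Solver using (module +-*-Solver)
  open import Data.Product using (_×_; _,_; proj₁; proj₂)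
  open import Relation.Binary.PropositionalEquality
  open import Defs using (ι; _^ℚ_; Counted)
  open Arithmetic using (n^[2b]*[2x]^b≤)
  open SolutionCounting using (IsSolution; HasSolution)

  ι≡mkℚ : ∀ n → ι n ≡ mkℚ (+ n) 0 (Coprimality.sym (Coprimality.1-coprimeTo n))
  ι≡mkℚ n = ℚ.normalize-coprime (Coprimality.sym (Coprimality.1-coprimeTo n))

  ι-mono-≤ : ∀ {m n} → m ℕ.≤ n → ι m ≤ ι n
  ι-mono-≤ {m} {n} m≤n = subst₂ _≤_ (sym (ι≡mkℚ m)) (sym (ι≡mkℚ n))
    (*≤* (subst₂ ℤ._≤_ (sym (ℤ.*-identityʳ (+ m))) (sym (ℤ.*-identityʳ (+ n))) (ℤ.+≤+ m≤n)))

  ι-cancel-≤ : ∀ {m n} → ι m ≤ ι n → m ℕ.≤ n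
  ι-cancel-≤ {m} {n} ιm≤ιn = ℤ.drop‿+≤+ (subst₂ ℤ._≤_ (ℤ.*-identityʳ (+ m)) (ℤ.*-identityʳ (+ n))
    (ℚ.drop-*≤* (subst₂ _≤_ (ι≡mkℚ m) (ι≡mkℚ n) ιm≤ιn)))

  ι-cancel-< : ∀ {m n} → ι m < ι n → m ℕ.< n
  ι-cancel-< {m} {n} ιm<ιn = ℤ.drop‿+<+ (subst₂ ℤ._<_ (ℤ.*-identityʳ (+ m)) (ℤ.*-identityʳ (+ n))
    (ℚ.drop-*<* (subst₂ _<_ (ι≡mkℚ m) (ι≡mkℚ n) ιm<ιn)))

  0≤ι : ∀ n → 0ℚ ≤ ι n
  0≤ι n = ι-mono-≤ {0} {n} ℕ.z≤n

  ι-+ : ∀ m n → ι (m ℕ.+ n) ≡ ι m + ι n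
  ι-+ m n = trans (cong (_/ 1) (trans (ℤ.pos-+ m n) (sym (cong₂ ℤ._+_ (ℤ.*-identityʳ (+ m)) (ℤ.*-identityʳ (+ n))))))
                  (cong₂ _+_ (sym (ι≡mkℚ m)) (sym (ι≡mkℚ n)))

  ι-* : ∀ m n → ι (m ℕ.* n) ≡ ι m * ι n
  ι-* m n = trans (cong (_/ 1) (ℤ.pos-* m n)) (cong₂ _*_ (sym (ι≡mkℚ m)) (sym (ι≡mkℚ n)))

  ι-^ : ∀ m n → ι (m ℕ.^ n) ≡ ι m ^ℚ n
  ι-^ m zero    = refl
  ι-^ m (suc n) = trans (ι-* m (m ℕ.^ n)) (cong (ι m *_) (ι-^ m n))

  *-mono-≤-nonNeg : ∀ {a b c d} → 0ℚ ≤ a → 0ℚ ≤ c → a ≤ b → c ≤ d → a * c ≤ b * d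
  *-mono-≤-nonNeg {a} {b} {c} {d} 0≤a 0≤c a≤b c≤d =
    ℚ.≤-trans (ℚ.*-monoʳ-≤-nonNeg c {{nonNegative 0≤c}} a≤b) (ℚ.*-monoˡ-≤-nonNeg b {{nonNegative (ℚ.≤-trans 0≤a a≤b)}} c≤d)

  0≤* : ∀ {a b} → 0ℚ ≤ a → 0ℚ ≤ b → 0ℚ ≤ a * b
  0≤* {a} {b} 0≤a 0≤b = ℚ.nonNegative⁻¹ _ {{ℚ.nonNeg*nonNeg⇒nonNeg a {{nonNegative 0≤a}} b {{nonNegative 0≤b}}}}

  ^ℚ-nonNeg : ∀ {p} n → 0ℚ ≤ p → 0ℚ ≤ p ^ℚ n
  ^ℚ-nonNeg zero    _   = 0≤ι 1
  ^ℚ-nonNeg (suc n) 0≤p = 0≤* 0≤p (^ℚ-nonNeg n 0≤p)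

  ^ℚ-monoˡ-≤ : ∀ {p q} n → 0ℚ ≤ p → p ≤ q → p ^ℚ n ≤ q ^ℚ n
  ^ℚ-monoˡ-≤ zero    _   _   = ℚ.≤-refl
  ^ℚ-monoˡ-≤ (suc n) 0≤p p≤q = *-mono-≤-nonNeg 0≤p (^ℚ-nonNeg n 0≤p) p≤q (^ℚ-monoˡ-≤ n 0≤p p≤q)

  ^ℚ-distrib-* : ∀ p q n → (p * q) ^ℚ n ≡ p ^ℚ n * q ^ℚ n
  ^ℚ-distrib-* p q zero    = sym (ℚ.*-identityˡ 1ℚ)
  ^ℚ-distrib-* p q (suc n) = trans (cong (p * q *_) (^ℚ-distrib-* p q n)) (interchange p q (p ^ℚ n) (q ^ℚ n))
    where
    interchange : ∀ a b c d → a * b * (c * d) ≡ a * c * (b * d)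
    interchange = +-*-Solver.solve 4 (λ a b c d → (a :* b) :* (c :* d) := (a :* c) :* (b :* d)) refl
      where open +-*-Solver

  ^ℚ-distribˡ-+-* : ∀ p m n → p ^ℚ (m ℕ.+ n) ≡ p ^ℚ m * p ^ℚ n
  ^ℚ-distribˡ-+-* p zero    n = sym (ℚ.*-identityˡ _)
  ^ℚ-distribˡ-+-* p (suc m) n = trans (cong (p *_) (^ℚ-distribˡ-+-* p m n)) (sym (ℚ.*-assoc p (p ^ℚ m) (p ^ℚ n)))

  1≤^ℚ : ∀ {p} n → 1ℚ ≤ p → 1ℚ ≤ p ^ℚ n
  1≤^ℚ zero    _   = ℚ.≤-refl
  1≤^ℚ (suc n) 1≤p = *-mono-≤-nonNeg (0≤ι 1) (0≤ι 1) 1≤p (1≤^ℚ n 1≤p)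

  ^ℚ≤1 : ∀ {p} n → 0ℚ ≤ p → p ≤ 1ℚ → p ^ℚ n ≤ 1ℚ
  ^ℚ≤1 zero    _   _   = ℚ.≤-refl
  ^ℚ≤1 (suc n) 0≤p p≤1 = *-mono-≤-nonNeg 0≤p (^ℚ-nonNeg n 0≤p) p≤1 (^ℚ≤1 n 0≤p p≤1)

  ^ℚ-monoʳ-≤ : ∀ {p} → 1ℚ ≤ p → ∀ {m n} → m ℕ.≤ n → p ^ℚ m ≤ p ^ℚ n
  ^ℚ-monoʳ-≤ {p} 1≤p {m} {n} m≤n = begin
    p ^ℚ m                       ≡⟨ sym (ℚ.*-identityʳ (p ^ℚ m)) ⟩
    p ^ℚ m * 1ℚ                  ≤⟨ ℚ.*-monoˡ-≤-nonNeg (p ^ℚ m) {{nonNegative (^ℚ-nonNeg m (ℚ.≤-trans (0≤ι 1) 1≤p))}} (1≤^ℚ (n ℕ.∸ m) 1≤p) ⟩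
    p ^ℚ m * p ^ℚ (n ℕ.∸ m)      ≡⟨ sym (^ℚ-distribˡ-+-* p m (n ℕ.∸ m)) ⟩
    p ^ℚ (m ℕ.+ (n ℕ.∸ m))       ≡⟨ cong (p ^ℚ_) (ℕ.m+[n∸m]≡n m≤n) ⟩
    p ^ℚ n                       ∎
    where open ℚ.≤-Reasoning

  floorℕ : ℚ → ℕ
  floorℕ X = ℤ.∣ ↥ X ∣ ℕ./ ↧ₙ X

  floorℕ-spec : ∀ X → 0ℚ ≤ X → ι (floorℕ X) ≤ X × X < ι (suc (floorℕ X))
  floorℕ-spec (mkℚ (+ n) d-1 _) _ rewrite ι≡mkℚ (n ℕ./ suc d-1) | ι≡mkℚ (suc (n ℕ./ suc d-1)) =
    *≤* (subst₂ ℤ._≤_ (ℤ.pos-* (n ℕ./ d) d) (sym (ℤ.*-identityʳ (+ n))) (ℤ.+≤+ (ℕ.m/n*n≤m n d))) ,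
    *<* (subst₂ ℤ._<_ (sym (ℤ.*-identityʳ (+ n))) (ℤ.pos-* (suc (n ℕ./ d)) d) (ℤ.+<+ n<[1+n/d]*d))
    where
    d : ℕ
    d = suc d-1
    n<[1+n/d]*d : n ℕ.< suc (n ℕ./ d) ℕ.* d
    n<[1+n/d]*d = ℕ.≤-<-trans (ℕ.≤-reflexive (ℕ.m≡m%n+[m/n]*n n d)) (ℕ.+-monoˡ-< (n ℕ./ d ℕ.* d) (ℕ.m%n<n n d))
  floorℕ-spec (mkℚ -[1+ _ ] _ _) (*≤* ())

  window-weight-≤ : ∀ g {x z} {X Z : ℚ} → ι x ≤ X → 0ℚ ≤ Z → ι z ≤ ι 3 * Z →
    ι (z ℕ.^ 2 ℕ.* x ℕ.+ z ℕ.^ (g ℕ.+ 2)) ≤ ι (3 ℕ.^ (g ℕ.+ 2)) * (Z ^ℚ 2 * X + Z ^ℚ (g ℕ.+ 2))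
  window-weight-≤ g {x} {z} {X} {Z} ιx≤X 0≤Z ιz≤3Z = begin
    ι (z ℕ.^ 2 ℕ.* x ℕ.+ z ℕ.^ k)                  ≡⟨ ι-window ⟩
    ι z ^ℚ 2 * ι x + ι z ^ℚ k                       ≤⟨ ℚ.+-mono-≤ (*-mono-≤-nonNeg (^ℚ-nonNeg 2 (0≤ι z)) (0≤ι x) (^ℚ-monoˡ-≤ 2 (0≤ι z) ιz≤3Z) ιx≤X)
                                                                 (^ℚ-monoˡ-≤ k (0≤ι z) ιz≤3Z) ⟩
    (ι 3 * Z) ^ℚ 2 * X + (ι 3 * Z) ^ℚ k             ≡⟨ cong₂ _+_ (trans (cong (_* X) (^ℚ-distrib-* (ι 3) Z 2)) (ℚ.*-assoc (ι 3 ^ℚ 2) (Z ^ℚ 2) X))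
                                                                 (^ℚ-distrib-* (ι 3) Z k) ⟩
    ι 3 ^ℚ 2 * (Z ^ℚ 2 * X) + ι 3 ^ℚ k * Z ^ℚ k     ≤⟨ ℚ.+-monoˡ-≤ (ι 3 ^ℚ k * Z ^ℚ k) (ℚ.*-monoʳ-≤-nonNeg (Z ^ℚ 2 * X) {{nonNegative 0≤Z²X}} 3²≤3ᵏ) ⟩
    ι 3 ^ℚ k * (Z ^ℚ 2 * X) + ι 3 ^ℚ k * Z ^ℚ k     ≡⟨ sym (ℚ.*-distribˡ-+ (ι 3 ^ℚ k) (Z ^ℚ 2 * X) (Z ^ℚ k)) ⟩
    ι 3 ^ℚ k * (Z ^ℚ 2 * X + Z ^ℚ k)                ≡⟨ cong (_* (Z ^ℚ 2 * X + Z ^ℚ k)) (sym (ι-^ 3 k)) ⟩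
    ι (3 ℕ.^ k) * (Z ^ℚ 2 * X + Z ^ℚ k)             ∎
    where
    open ℚ.≤-Reasoning
    k : ℕ
    k = g ℕ.+ 2
    ι-window : ι (z ℕ.^ 2 ℕ.* x ℕ.+ z ℕ.^ k) ≡ ι z ^ℚ 2 * ι x + ι z ^ℚ k
    ι-window = trans (ι-+ (z ℕ.^ 2 ℕ.* x) (z ℕ.^ k)) (cong₂ _+_ (trans (ι-* (z ℕ.^ 2) x) (cong (_* ι x) (ι-^ z 2))) (ι-^ z k))
    0≤Z²X : 0ℚ ≤ Z ^ℚ 2 * X
    0≤Z²X = 0≤* (^ℚ-nonNeg 2 0≤Z) (ℚ.≤-trans (0≤ι x) ιx≤X)
    3²≤3ᵏ : ι 3 ^ℚ 2 ≤ ι 3 ^ℚ k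
    3²≤3ᵏ = ^ℚ-monoʳ-≤ (ι-mono-≤ {1} {3} (ℕ.s≤s ℕ.z≤n)) (ℕ.m≤n+m 2 g)

  rescale : ∀ g b a {n x z D₀} {X Z : ℚ} → 1 ℕ.≤ a →
    n ℕ.^ (2 ℕ.* b) ℕ.* x ℕ.^ b ℕ.≤ D₀ ℕ.^ (2 ℕ.* b) ℕ.* (x ℕ.* x) ℕ.* (z ℕ.^ 2 ℕ.* x ℕ.+ z ℕ.^ (g ℕ.+ 2)) ℕ.^ (2 ℕ.* b) →
    1ℚ ≤ X → X ≤ ι (2 ℕ.* x) → ι x ≤ X → 0ℚ ≤ Z → ι z ≤ ι 3 * Z →
    ι n ^ℚ (2 ℕ.* b) * X ^ℚ b ≤ ι (2 ℕ.* D₀ ℕ.* 3 ℕ.^ (g ℕ.+ 2)) ^ℚ (2 ℕ.* b) * X ^ℚ (2 ℕ.* a) * (Z ^ℚ 2 * X + Z ^ℚ (g ℕ.+ 2)) ^ℚ (2 ℕ.* b)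
  rescale g b a {n} {x} {z} {D₀} {X} {Z} 1≤a bound 1≤X X≤ι2x ιx≤X 0≤Z ιz≤3Z = begin
    ι n ^ℚ k * X ^ℚ b                                ≤⟨ ℚ.*-monoˡ-≤-nonNeg (ι n ^ℚ k) {{nonNegative (^ℚ-nonNeg k (0≤ι n))}} (^ℚ-monoˡ-≤ b 0≤X X≤ι2x) ⟩
    ι n ^ℚ k * ι (2 ℕ.* x) ^ℚ b                      ≡⟨ sym ι-left ⟩
    ι (n ℕ.^ k ℕ.* (2 ℕ.* x) ℕ.^ b)                  ≤⟨ ι-mono-≤ (n^[2b]*[2x]^b≤ {n} {x} {b} {D₀} {x ℕ.* x} bound) ⟩
    ι (D ℕ.^ k ℕ.* (x ℕ.* x) ℕ.* W ℕ.^ k)            ≡⟨ ι-right ⟩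
    ι D ^ℚ k * (ι x * ι x) * ι W ^ℚ k                ≤⟨ from-x-z ⟩
    ι D ^ℚ k * (X * X) * (ι 3ᵍ⁺² * Wℚ) ^ℚ k          ≡⟨ regroup ⟩
    (ι D * ι 3ᵍ⁺²) ^ℚ k * (X * X) * Wℚ ^ℚ k          ≤⟨ ℚ.*-monoʳ-≤-nonNeg (Wℚ ^ℚ k) {{nonNegative (^ℚ-nonNeg k 0≤Wℚ)}}
                                                          (ℚ.*-monoˡ-≤-nonNeg ((ι D * ι 3ᵍ⁺²) ^ℚ k) {{nonNegative 0≤[D*3ᵍ⁺²]ᵏ}} X*X≤X²ᵃ) ⟩
    (ι D * ι 3ᵍ⁺²) ^ℚ k * X ^ℚ (2 ℕ.* a) * Wℚ ^ℚ k   ≡⟨ cong (λ c → c ^ℚ k * X ^ℚ (2 ℕ.* a) * Wℚ ^ℚ k) (sym (ι-* D 3ᵍ⁺²)) ⟩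
    ι (D ℕ.* 3ᵍ⁺²) ^ℚ k * X ^ℚ (2 ℕ.* a) * Wℚ ^ℚ k   ∎
    where
    open ℚ.≤-Reasoning
    k : ℕ
    k = 2 ℕ.* b
    D : ℕ
    D = 2 ℕ.* D₀
    3ᵍ⁺² : ℕ
    3ᵍ⁺² = 3 ℕ.^ (g ℕ.+ 2)
    W : ℕ
    W = z ℕ.^ 2 ℕ.* x ℕ.+ z ℕ.^ (g ℕ.+ 2)
    Wℚ : ℚ
    Wℚ = Z ^ℚ 2 * X + Z ^ℚ (g ℕ.+ 2)
    0≤X : 0ℚ ≤ X
    0≤X = ℚ.≤-trans (0≤ι 1) 1≤X
    0≤Wℚ : 0ℚ ≤ Wℚ
    0≤Wℚ = ℚ.+-mono-≤ {0ℚ} {_} {0ℚ} (0≤* (^ℚ-nonNeg 2 0≤Z) 0≤X) (^ℚ-nonNeg (g ℕ.+ 2) 0≤Z)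
    0≤[D*3ᵍ⁺²]ᵏ : 0ℚ ≤ (ι D * ι 3ᵍ⁺²) ^ℚ k
    0≤[D*3ᵍ⁺²]ᵏ = ^ℚ-nonNeg k (0≤* (0≤ι D) (0≤ι 3ᵍ⁺²))
    ι-left : ι (n ℕ.^ k ℕ.* (2 ℕ.* x) ℕ.^ b) ≡ ι n ^ℚ k * ι (2 ℕ.* x) ^ℚ b
    ι-left = trans (ι-* (n ℕ.^ k) ((2 ℕ.* x) ℕ.^ b)) (cong₂ _*_ (ι-^ n k) (ι-^ (2 ℕ.* x) b))
    ι-right : ι (D ℕ.^ k ℕ.* (x ℕ.* x) ℕ.* W ℕ.^ k) ≡ ι D ^ℚ k * (ι x * ι x) * ι W ^ℚ k
    ι-right = trans (ι-* (D ℕ.^ k ℕ.* (x ℕ.* x)) (W ℕ.^ k))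
                    (cong₂ _*_ (trans (ι-* (D ℕ.^ k) (x ℕ.* x)) (cong₂ _*_ (ι-^ D k) (ι-* x x))) (ι-^ W k))
    from-x-z : ι D ^ℚ k * (ι x * ι x) * ι W ^ℚ k ≤ ι D ^ℚ k * (X * X) * (ι 3ᵍ⁺² * Wℚ) ^ℚ k
    from-x-z = *-mono-≤-nonNeg (0≤* (^ℚ-nonNeg k (0≤ι D)) (0≤* (0≤ι x) (0≤ι x))) (^ℚ-nonNeg k (0≤ι W))
      (ℚ.*-monoˡ-≤-nonNeg (ι D ^ℚ k) {{nonNegative (^ℚ-nonNeg k (0≤ι D))}} (*-mono-≤-nonNeg (0≤ι x) (0≤ι x) ιx≤X ιx≤X))
      (^ℚ-monoˡ-≤ k (0≤ι W) (window-weight-≤ g {x} {z} ιx≤X 0≤Z ιz≤3Z))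
    X*X≤X²ᵃ : X * X ≤ X ^ℚ (2 ℕ.* a)
    X*X≤X²ᵃ = ℚ.≤-trans (ℚ.≤-reflexive (cong (X *_) (sym (ℚ.*-identityʳ X)))) (^ℚ-monoʳ-≤ 1≤X (ℕ.*-monoʳ-≤ 2 1≤a))
    regroup : ι D ^ℚ k * (X * X) * (ι 3ᵍ⁺² * Wℚ) ^ℚ k ≡ (ι D * ι 3ᵍ⁺²) ^ℚ k * (X * X) * Wℚ ^ℚ k
    regroup = begin-equality
      ι D ^ℚ k * (X * X) * (ι 3ᵍ⁺² * Wℚ) ^ℚ k                 ≡⟨ cong (ι D ^ℚ k * (X * X) *_) (^ℚ-distrib-* (ι 3ᵍ⁺²) Wℚ k) ⟩
      ι D ^ℚ k * (X * X) * (ι 3ᵍ⁺² ^ℚ k * Wℚ ^ℚ k)            ≡⟨ shuffle (ι D ^ℚ k) (X * X) (ι 3ᵍ⁺² ^ℚ k) (Wℚ ^ℚ k) ⟩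
      ι D ^ℚ k * ι 3ᵍ⁺² ^ℚ k * (X * X) * Wℚ ^ℚ k              ≡⟨ cong (λ c → c * (X * X) * Wℚ ^ℚ k) (sym (^ℚ-distrib-* (ι D) (ι 3ᵍ⁺²) k)) ⟩
      (ι D * ι 3ᵍ⁺²) ^ℚ k * (X * X) * Wℚ ^ℚ k                 ∎
      where
      shuffle : ∀ a b c d → a * b * (c * d) ≡ a * c * b * d
      shuffle = +-*-Solver.solve 4 (λ a b c d → a :* b :* (c :* d) := a :* c :* b :* d) refl
        where open +-*-Solver

  i*i≡+∣i∣*∣i∣ : ∀ i → i ℤ.* i ≡ + (ℤ.∣ i ∣ ℕ.* ℤ.∣ i ∣)
  i*i≡+∣i∣*∣i∣ (+ n)    = sym (ℤ.pos-* n n)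
  i*i≡+∣i∣*∣i∣ -[1+ n ] = refl

  +-^ : ∀ n k → (+ n) ℤ.^ k ≡ + (n ℕ.^ k)
  +-^ n zero    = refl
  +-^ n (suc k) = trans (cong (+ n ℤ.*_) (+-^ n k)) (sym (ℤ.pos-* n (n ℕ.^ k)))

  equation-in-ℕ : ∀ {N g u v d} → + 4 ℤ.* (+ N) ℤ.^ g ≡ u ℤ.* u ℤ.+ (+ d) ℤ.* (v ℤ.* v) →
                  ℤ.∣ u ∣ ℕ.* ℤ.∣ u ∣ ℕ.+ d ℕ.* (ℤ.∣ v ∣ ℕ.* ℤ.∣ v ∣) ≡ 4 ℕ.* N ℕ.^ g
  equation-in-ℕ {N} {g} {u} {v} {d} eq = ℤ.+-injective (begin-equality
    + (ℤ.∣ u ∣ ℕ.* ℤ.∣ u ∣ ℕ.+ d ℕ.* (ℤ.∣ v ∣ ℕ.* ℤ.∣ v ∣))       ≡⟨ ℤ.pos-+ _ (d ℕ.* (ℤ.∣ v ∣ ℕ.* ℤ.∣ v ∣)) ⟩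
    + (ℤ.∣ u ∣ ℕ.* ℤ.∣ u ∣) ℤ.+ + (d ℕ.* (ℤ.∣ v ∣ ℕ.* ℤ.∣ v ∣)) ≡⟨ cong₂ ℤ._+_ (sym (i*i≡+∣i∣*∣i∣ u))
                                                                       (trans (ℤ.pos-* d _) (cong (+ d ℤ.*_) (sym (i*i≡+∣i∣*∣i∣ v)))) ⟩
    u ℤ.* u ℤ.+ (+ d) ℤ.* (v ℤ.* v)                               ≡⟨ sym eq ⟩
    + 4 ℤ.* (+ N) ℤ.^ g                                           ≡⟨ cong (+ 4 ℤ.*_) (+-^ N g) ⟩
    + 4 ℤ.* + (N ℕ.^ g)                                           ≡⟨ sym (ℤ.pos-* 4 (N ℕ.^ g)) ⟩
    + (4 ℕ.* N ℕ.^ g)                                             ∎)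
    where open ℤ.≤-Reasoning

  module Rounding (g : ℕ) {X Z : ℚ} (2≤X : ι 2 ≤ X) (0<Z : 0ℚ < Z) (X≤Z²ᵍ : X ≤ Z ^ℚ (2 ℕ.* g)) (Z≤X : Z ≤ X) where

    0≤Z : 0ℚ ≤ Z
    0≤Z = ℚ.<⇒≤ 0<Z

    1≤X : 1ℚ ≤ X
    1≤X = ℚ.≤-trans (ι-mono-≤ {1} {2} (ℕ.s≤s ℕ.z≤n)) 2≤X

    1≤Z : 1ℚ ≤ Z
    1≤Z = ℚ.≮⇒≥ λ Z<1 → ℕ.<⇒≱ ℕ.≤-refl (ι-cancel-≤ {2} {1} (ℚ.≤-trans 2≤X (ℚ.≤-trans X≤Z²ᵍ (^ℚ≤1 (2 ℕ.* g) 0≤Z (ℚ.<⇒≤ Z<1)))))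

    opaque
      x : ℕ
      x = floorℕ X

      ιx≤X : ι x ≤ X
      ιx≤X = proj₁ (floorℕ-spec X (ℚ.≤-trans (0≤ι 1) 1≤X))

      X<ι[1+x] : X < ι (suc x)
      X<ι[1+x] = proj₂ (floorℕ-spec X (ℚ.≤-trans (0≤ι 1) 1≤X))

    1≤x : 1 ℕ.≤ x
    1≤x = ℕ.≤-trans (ℕ.s≤s ℕ.z≤n) (ℕ.≤-pred (ι-cancel-< {2} {suc x} (ℚ.≤-<-trans 2≤X X<ι[1+x])))

    instance
      x≢0 : ℕ.NonZero x
      x≢0 = ℕ.>-nonZero 1≤x

    X≤ι2x : X ≤ ι (2 ℕ.* x)
    X≤ι2x = ℚ.<⇒≤ (ℚ.<-≤-trans X<ι[1+x] (ι-mono-≤ {suc x} {2 ℕ.* x} (ℕ.≤-trans (ℕ.+-monoˡ-≤ x 1≤x) (ℕ.≤-reflexive (cong (x ℕ.+_) (sym (ℕ.+-identityʳ x)))))))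

    2X<ι[2+2x] : ι 2 * X < ι (2 ℕ.* suc x)
    2X<ι[2+2x] = ℚ.<-≤-trans (ℚ.*-monoʳ-<-pos (ι 2) X<ι[1+x]) (ℚ.≤-reflexive (sym (ι-* 2 (suc x))))

    opaque
      ⌊2Z⌋ : ℕ
      ⌊2Z⌋ = floorℕ (ι 2 * Z)

      ι⌊2Z⌋≤2Z : ι ⌊2Z⌋ ≤ ι 2 * Z
      ι⌊2Z⌋≤2Z = proj₁ (floorℕ-spec (ι 2 * Z) (0≤* (0≤ι 2) 0≤Z))

      2Z<ι[1+⌊2Z⌋] : ι 2 * Z < ι (suc ⌊2Z⌋)
      2Z<ι[1+⌊2Z⌋] = proj₂ (floorℕ-spec (ι 2 * Z) (0≤* (0≤ι 2) 0≤Z))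

    z : ℕ
    z = suc ⌊2Z⌋

    ιz≤3Z : ι z ≤ ι 3 * Z
    ιz≤3Z = begin
      ι z                  ≡⟨ trans (cong ι (ℕ.+-comm 1 ⌊2Z⌋)) (ι-+ ⌊2Z⌋ 1) ⟩
      ι ⌊2Z⌋ + 1ℚ          ≤⟨ ℚ.+-mono-≤ ι⌊2Z⌋≤2Z 1≤Z ⟩
      ι 2 * Z + Z          ≡⟨ cong (λ t → ι 2 * Z + t) (sym (ℚ.*-identityˡ Z)) ⟩
      ι 2 * Z + 1ℚ * Z     ≡⟨ sym (ℚ.*-distribʳ-+ Z (ι 2) 1ℚ) ⟩
      (ι 2 + 1ℚ) * Z       ≡⟨ cong (_* Z) (sym (ι-+ 2 1)) ⟩
      ι 3 * Z              ∎
      where open ℚ.≤-Reasoning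

    z≤6x : z ℕ.≤ 6 ℕ.* x
    z≤6x = ℕ.≤-trans ⌊2Z⌋<2+2x (ℕ.≤-trans (ℕ.≤-reflexive (2[1+x]≡2x+2 x))
             (ℕ.≤-trans (ℕ.+-monoʳ-≤ (2 ℕ.* x) (ℕ.≤-trans (ℕ.s≤s (ℕ.s≤s ℕ.z≤n)) (ℕ.*-monoʳ-≤ 4 1≤x))) (ℕ.≤-reflexive (2x+4x≡6x x))))
      where
      ⌊2Z⌋<2+2x : ⌊2Z⌋ ℕ.< 2 ℕ.* suc x
      ⌊2Z⌋<2+2x = ι-cancel-< (ℚ.≤-<-trans ι⌊2Z⌋≤2Z
                                (ℚ.≤-<-trans (ℚ.*-monoˡ-≤-nonNeg (ι 2) {{nonNegative (0≤ι 2)}} Z≤X) 2X<ι[2+2x]))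
      2[1+x]≡2x+2 : ∀ x → 2 ℕ.* suc x ≡ 2 ℕ.* x ℕ.+ 2
      2[1+x]≡2x+2 = solve-∀
      2x+4x≡6x : ∀ x → 2 ℕ.* x ℕ.+ 4 ℕ.* x ≡ 6 ℕ.* x
      2x+4x≡6x = solve-∀

    counted⇒solution : ∀ {t} → Counted g X Z t → HasSolution g x z t
    counted⇒solution {d , p , p′} (_ , X≤ιd , ιd<2X , (_ , _ , _ , _ , ιp<2Z , _ , ιp′<2Z , u , v , _ , v≢0 , gcd≡1 , eq)) =
      ℤ.∣ u ∣ , ℤ.∣ v ∣ , record
        { x≤d      = ι-cancel-≤ (ℚ.≤-trans ιx≤X X≤ιd)
        ; d≤2x+1   = ℕ.≤-pred (subst (d ℕ.<_) (double-suc x) (ι-cancel-< (ℚ.<-trans ιd<2X 2X<ι[2+2x])))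
        ; p<z      = ι-cancel-< (ℚ.<-trans ιp<2Z 2Z<ι[1+⌊2Z⌋])
        ; p′<z     = ι-cancel-< (ℚ.<-trans ιp′<2Z 2Z<ι[1+⌊2Z⌋])
        ; v≢0      = ℕ.≢-nonZero (λ ∣v∣≡0 → v≢0 (ℤ.∣i∣≡0⇒i≡0 ∣v∣≡0))
        ; coprime  = Coprimality.gcd≡1⇒coprime gcd≡1
        ; equation = equation-in-ℕ {p ℕ.* p′} {g} {u} {v} {d} eq
        }
      where
      double-suc : ∀ x → 2 ℕ.* suc x ≡ suc (2 ℕ.* x ℕ.+ 1)
      double-suc = solve-∀


open import Defs
open import Data.Nat as ℕ using (ℕ; _≤_)
open import Data.Nat.Primality using (Prime)
open import Data.Integer as ℤ using (ℤ)
open import Data.Rational as ℚ using (ℚ; ↥_; ↧ₙ_)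
open import Data.Product using (_×_; ∃)
open import Data.List using (List; length)
open import Data.List.Relation.Unary.All using (All)
open import Data.List.Relation.Unary.Unique.Propositional using (Unique)

open import Data.Product using (_,_; proj₁; proj₂)
import Data.List.Relation.Unary.All as All
import Data.Nat.Properties as ℕ
open SolutionCounting using (triples-bound)
open RationalBounds using (rescale; module Rounding)

proposition2 : ∀ (g : ℕ) → Prime g → 3 ≤ g →
    ∀ (ε : ℚ) → ℚ.Positive ε →
    ∃ λ (C : ℕ) →
    ∀ (X Z : ℚ) → ι 2 ℚ.≤ X → ℚ.0ℚ ℚ.< Z → X ℚ.≤ Z ^ℚ (2 ℕ.* g) → Z ℚ.≤ X →
    ∀ (L : List (ℕ × ℕ × ℕ)) → Unique L → All (Counted g X Z) L →
    (ι (length L) ^ℚ (2 ℕ.* ↧ₙ ε)) ℚ.* (X ^ℚ (↧ₙ ε))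
    ℚ.≤ ((ι C ^ℚ (2 ℕ.* ↧ₙ ε)) ℚ.* (X ^ℚ (2 ℕ.* ℤ.∣ ↥ ε ∣)))
    ℚ.* (((Z ^ℚ 2) ℚ.* X ℚ.+ Z ^ℚ (g ℕ.+ 2)) ^ℚ (2 ℕ.* ↧ₙ ε))
proposition2 g _ 3≤g (ℚ.mkℚ (ℤ.+[1+ a-1 ]) b-1 _) _ =
  2 ℕ.* D ℕ.* 3 ℕ.^ (g ℕ.+ 2) , λ X Z 2≤X 0<Z X≤Z²ᵍ Z≤X L L! L-counted →
    let open Rounding g 2≤X 0<Z X≤Z²ᵍ Z≤X in
    rescale g b a {length L} {x} {z} {D} (ℕ.s≤s ℕ.z≤n)
      (proj₂ (triples-bound g b) x z z≤6x L! (All.map counted⇒solution L-counted))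
      1≤X X≤ι2x ιx≤X 0≤Z ιz≤3Z
  where
  a b : ℕ
  a = ℕ.suc a-1
  b = ℕ.suc b-1
  instance
    g≢0 : ℕ.NonZero g
    g≢0 = ℕ.>-nonZero (ℕ.≤-trans (ℕ.s≤s ℕ.z≤n) 3≤g)
  D : ℕ
  D = proj₁ (triples-bound g b)
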